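{- Let $G$ be a graph with $n$ vertices and let $M=M[IAS(G)]$ be its isotropic matroid. Every graph falls under precisely one of the following four cases. \begin{enumerate} \item If $n=0$ then $\kappa^{\ast}(M)=0$ and $\tau(M)=\infty$. \item If $n=1$ or $G$ is disconnected, then $\tau(M)=\kappa^{\ast}(M)=1$. \item If $n>1$, $G$ is connected, and $G$ has a pendant vertex or a pair of twin vertices, then $\tau(M)=\kappa^{\ast}(M)=2$. \item If $n>1$, $G$ is connected, and $G$ has neither a pendant vertex nor a pair of twin vertices, then $\tau(M)=\kappa^{\ast}(M)=3$. \end{enumerate}
   Context: A graph is a finite looped simple graph: each edge joins one or two vertices, and no two edges have the same ends; an edge on one vertex is a loop. "Adjacent"/"neighbor" refer only to non-loop edges; $N_G(v)=\{w\neq v\mid vw\in E(G)\}$, and $n=|V(G)|$. The adjacency matrix $A(G)$ is the $V(G)\times V(G)$ matrix over $GF(2)$ with diagonal entry $1$ at $v$ iff $v$ is looped and off-diagonal entry $1$ at $(v,w)$ iff $v,w$ are neighbors. The isotropic matroid $M[IAS(G)]$ is the binary matroid represented by the $V(G)\times 3V(G)$ matrix $IAS(G)=(I\;A(G)\;A(G)+I)$; its ground set $W(G)$ has $3n$ elements $\phi_G(v),\chi_G(v),\psi_G(v)$ ($v\in V(G)$), corresponding to the $v$ columns of $I$, $A(G)$, $A(G)+I$. Distinct vertices $v,w$ are twins if $N_G(v)-\{w\}=N_G(w)-\{v\}$; $v$ is pendant on $w$ if $N_G(v)=\{w\}$. For a matroid $M$ with ground set $W$ and rank function $r$, $\lambda(S)=r(S)+r(W-S)-r(M)$.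 A subset $S\subseteq W$ is an ordinary $k$-separation if $\lambda(S)<k$ and $|S|,|W-S|\ge k$; a cyclic $k$-separation if $\lambda(S)<k$ and both $S$ and $W-S$ are dependent. $\tau(M)$ is the least $k$ such that $M$ has an ordinary $k$-separation ($\infty$ if none); $\kappa^{\ast}(M)=\min(\{k\mid M\text{ has a cyclic }k\text{ -separation}\}\cup\{|W|-r(M)\})$. -}

module Defs where

open import Data.Nat using (ℕ; zero; suc; _+_; _*_; _∸_; _≤_; _<_)
open import Data.Bool using (Bool; true; false; _∧_; _xor_; not; if_then_else_)
open import Data.Fin using (Fin; zero; suc)
open import Data.Fin.Properties using (_≟_)
open import Data.Product using (Σ; ∃; ∃-syntax; _×_; _,_)
open import Data.Sum using (_⊎_)
open import Data.Maybe using (Maybe; just; nothing)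
open import Relation.Nullary using (¬_; does)
open import Relation.Binary.PropositionalEquality using (_≡_; _≢_)

-- Looped simple graphs on vertex set Fin n.
-- adj v w = true  (v ≠ w) : v and w are neighbours
-- adj v v = true          : v is looped
record Graph (n : ℕ) : Set where
  field
    adj : Fin n → Fin n → Bool
    sym : ∀ v w → adj v w ≡ adj w v
open Graph public

Nbr : ∀ {n} → Graph n → Fin n → Fin n → Set
Nbr G v w = (w ≢ v) × (adj G v w ≡ true)

_⇔_ : Set → Set → Set
P ⇔ Q = (P → Q) × (Q → P)

PendantOn : ∀ {n} → Graph n → Fin n → Fin n → Set
PendantOn G v w = ∀ u → Nbr G v u ⇔ (u ≡ w)

HasPendant : ∀ {n} → Graph n → Set
HasPendant G = ∃[ v ] ∃[ w ] PendantOn G v w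

Twins : ∀ {n} → Graph n → Fin n → Fin n → Set
Twins G v w = (v ≢ w) × (∀ u → (Nbr G v u × (u ≢ w)) ⇔ (Nbr G w u × (u ≢ v)))

HasTwins : ∀ {n} → Graph n → Set
HasTwins G = ∃[ v ] ∃[ w ] Twins G v w

-- G is disconnected: the vertex set splits into two nonempty parts
-- with no edge between them.  (The empty graph is not disconnected.)
Disconnected : ∀ {n} → Graph n → Set
Disconnected {n} G =
  Σ (Fin n → Bool) λ P →
    (∃[ v ] P v ≡ true) × (∃[ w ] P w ≡ false) ×
    (∀ v w → P v ≡ true → P w ≡ false → adj G v w ≡ false)

Connected : ∀ {n} → Graph n → Set
Connected G = ¬ Disconnected G

data Kind : Set where
  φ χ ψ : Kind

W : ℕ → Set
W n = Fin n × Kind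

δ : ∀ {n} → Fin n → Fin n → Bool
δ u v = does (u ≟ v)

-- column of IAS(G) = (I  A(G)  A(G)+I) indexed by x, entry in row u
column : ∀ {n} → Graph n → W n → Fin n → Bool
column G (v , φ) u = δ u v
column G (v , χ) u = adj G u v
column G (v , ψ) u = adj G u v xor δ u v

xorFin : ∀ {m} → (Fin m → Bool) → Bool
xorFin {zero}  f = false
xorFin {suc m} f = f zero xor xorFin (λ i → f (suc i))

countFin : ∀ {m} → (Fin m → Bool) → ℕ
countFin {zero}  f = 0
countFin {suc m} f = (if f zero then 1 else 0) + countFin (λ i → f (suc i))

xorW : ∀ {n} → (W n → Bool) → Bool
xorW f = xorFin (λ v → f (v , φ) xor (f (v , χ) xor f (v , ψ)))

Subset : ℕ → Set
Subset n = W n → Bool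

∣_∣ : ∀ {n} → Subset n → ℕ
∣ S ∣ = countFin (λ v → S (v , φ)) + (countFin (λ v → S (v , χ)) + countFin (λ v → S (v , ψ)))

_⊆_ : ∀ {n} → Subset n → Subset n → Set
U ⊆ T = ∀ x → U x ≡ true → T x ≡ true

∁ : ∀ {n} → Subset n → Subset n
∁ S x = not (S x)

full : ∀ {n} → Subset n
full x = true

Dependent : ∀ {n} → Graph n → Subset n → Set
Dependent G T =
  Σ (Subset _) λ U → (U ⊆ T) × (∃[ x ] U x ≡ true) ×
    (∀ u → xorW (λ x → U x ∧ column G x u) ≡ false)

Independent : ∀ {n} → Graph n → Subset n → Set
Independent G T = ¬ Dependent G T

IsRank : ∀ {n} → Graph n → Subset n → ℕ → Set
IsRank G S k =
  (Σ (Subset _) λ T → T ⊆ S × Independent G T × ∣ T ∣ ≡ k) ×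
  (∀ T → T ⊆ S → Independent G T → ∣ T ∣ ≤ k)

-- λ(S) = l, where λ(S) = r(S) + r(W - S) - r(M)
IsLambda : ∀ {n} → Graph n → Subset n → ℕ → Set
IsLambda G S l = ∃[ a ] ∃[ b ] ∃[ c ]
  (IsRank G S a × IsRank G (∁ S) b × IsRank G full c × a + b ≡ l + c)

LambdaLt : ∀ {n} → Graph n → Subset n → ℕ → Set
LambdaLt G S k = ∃[ l ] (IsLambda G S l × l < k)

OrdinarySep : ∀ {n} → Graph n → ℕ → Subset n → Set
OrdinarySep G k S = LambdaLt G S k × k ≤ ∣ S ∣ × k ≤ ∣ ∁ S ∣

CyclicSep : ∀ {n} → Graph n → ℕ → Subset n → Set
CyclicSep G k S = LambdaLt G S k × Dependent G S × Dependent G (∁ S)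

-- τ(M) = t, with nothing standing for ∞
IsTau : ∀ {n} → Graph n → Maybe ℕ → Set
IsTau G nothing  = ∀ k S → ¬ OrdinarySep G k S
IsTau G (just m) = (∃[ S ] OrdinarySep G m S) × (∀ k S → OrdinarySep G k S → m ≤ k)

-- κ*(M) = m : minimum of {k | cyclic k-separation} ∪ {|W| - r(M)}
IsKappa : ∀ {n} → Graph n → ℕ → Set
IsKappa {n} G m = ∃[ r ] (IsRank G full r ×
  ((m ≡ 3 * n ∸ r) ⊎ (∃[ S ] CyclicSep G m S)) ×
  m ≤ 3 * n ∸ r ×
  (∀ k S → CyclicSep G k S → m ≤ k))

Case1 : ∀ {n} → Graph n → Set
Case1 {n} G = n ≡ 0

Case2 : ∀ {n} → Graph n → Set
Case2 {n} G = (n ≡ 1) ⊎ Disconnected G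

Case3 : ∀ {n} → Graph n → Set
Case3 {n} G = (1 < n) × Connected G × (HasPendant G ⊎ HasTwins G)

Case4 : ∀ {n} → Graph n → Set
Case4 {n} G = (1 < n) × Connected G × ¬ HasPendant G × ¬ HasTwins G

module Submission where

-- Over GF(2), if the spans of S and of its complement share a nonzero vector then λ(S) ≥ 1, and if they share
-- two distinct nonzero vectors then λ(S) ≥ 2: each shared vector can be exchanged into a basis of S while being
-- spanned by the complement, so (by Steinitz) one basis member becomes redundant in a spanning set of M.
-- In a connected graph with n > 1 call a vertex S-heavy when two of its columns φ, χ, ψ lie in S; since the
-- three columns sum to zero, all three then lie in the span of S. An edge from an S-heavy to an S-light vertex
-- produces two distinct nonzero shared vectors, and if all vertices are on one side, columns from the other side
-- are shared. Hence λ(S) ≥ 1 for every nontrivial S, and λ(S) ≥ 2 once both sides contain two elements with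
-- distinct columns, which is guaranteed when there are no pendant vertices and no twins.
-- Conversely, a pendant vertex or a pair of twins gives two parallel columns, hence a 2-separation; the three
-- elements of a vertex form a 3-separation; a union of components gives a 1-separation; and for n = 1 some
-- χ or ψ column is zero.

open import Defs
open import Data.Nat using (ℕ; zero; suc; _+_; _*_; _∸_; _≤_; _<_; z≤n; s≤s)
import Data.Nat.Properties as ℕ
open import Data.Nat.Tactic.RingSolver using (solve-∀)
open import Data.Bool using (Bool; true; false; _∧_; _∨_; _xor_; not; if_then_else_)
open import Data.Bool.Properties
  using ( xor-assoc; xor-comm; xor-same; xor-identityʳ; xor-∧-commutativeRing
        ; ∧-distribˡ-xor; ∧-distribʳ-xor; ∧-zeroʳ; ∧-identityʳ; ∧-assoc; ∧-comm
        ; ∨-zeroʳ; ∨-identityʳ)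
import Data.Bool.Properties as 𝔹
open import Data.Fin using (Fin; zero; suc)
open import Data.Fin.Properties using (_≟_; suc-injective; any?; all?)
open import Data.Product using (Σ; ∃; _×_; _,_; proj₁; proj₂)
open import Data.Sum using (_⊎_; inj₁; inj₂; [_,_]′)
open import Data.Maybe using (just; nothing)
open import Data.Empty using (⊥; ⊥-elim)
open import Relation.Nullary using (¬_; Dec; yes; no; does)
open import Relation.Nullary.Decidable using (decidable-stable; _×-dec_; _→-dec_; ¬?)
open import Relation.Binary.PropositionalEquality
  using (_≡_; _≢_; refl; cong; cong₂; trans; subst; module ≡-Reasoning)
  renaming (sym to ≡-sym)
open import Data.Fin.Subset.Properties using (anySubset?)
open import Data.Vec using (lookup; tabulate)
open import Data.Vec.Properties using (lookup∘tabulate)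
import Relation.Nullary.Decidable as Dec
open import Algebra.Bundles using (CommutativeRing)
open import Algebra.Properties.CommutativeSemigroup
  (CommutativeRing.+-commutativeSemigroup xor-∧-commutativeRing) using () renaming (interchange to xor-interchange)

∧-trueˡ : ∀ {a b} → a ∧ b ≡ true → a ≡ true
∧-trueˡ {true} _ = refl

∧-trueʳ : ∀ {a b} → a ∧ b ≡ true → b ≡ true
∧-trueʳ {true} h = h

∧-true : ∀ {a b} → a ≡ true → b ≡ true → a ∧ b ≡ true
∧-true refl refl = refl

∨-trueˡ : ∀ {a} b → a ≡ true → a ∨ b ≡ true
∨-trueˡ b refl = refl

∨-trueʳ : ∀ a {b} → b ≡ true → a ∨ b ≡ true
∨-trueʳ false refl = refl
∨-trueʳ true refl = refl

∨-true-false : ∀ {a b} → a ∨ b ≡ true → b ≡ false → a ≡ true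
∨-true-false {true} _ _ = refl
∨-true-false {false} refl ()

xor-true : ∀ {a b} → a xor b ≡ true → (a ≡ true) ⊎ (b ≡ true)
xor-true {true} _ = inj₁ refl
xor-true {false} h = inj₂ h

xor-false : ∀ a b → a xor b ≡ false → b ≡ a
xor-false false b h = h
xor-false true false ()
xor-false true true h = refl

xor-cancelˡ : ∀ a b → a xor (a xor b) ≡ b
xor-cancelˡ a b = trans (≡-sym (xor-assoc a a b)) (cong (_xor b) (xor-same a))

xor-cancelʳ : ∀ a b → (a xor b) xor b ≡ a
xor-cancelʳ a b = trans (xor-assoc a b b) (trans (cong (a xor_) (xor-same b)) (xor-identityʳ a))

not-true : ∀ {b} → not b ≡ true → b ≡ false
not-true {false} _ = refl

not-false : ∀ {b} → not b ≡ false → b ≡ true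
not-false {true} _ = refl

false⇒not-true : ∀ {b} → b ≡ false → not b ≡ true
false⇒not-true refl = refl

true≢false : true ≢ false
true≢false ()

b≢b-xor-true : ∀ b → b ≢ b xor true
b≢b-xor-true false ()
b≢b-xor-true true ()

xorFin-cong : ∀ {m} {f g : Fin m → Bool} → (∀ i → f i ≡ g i) → xorFin f ≡ xorFin g
xorFin-cong {zero} h = refl
xorFin-cong {suc m} h = cong₂ _xor_ (h zero) (xorFin-cong (λ i → h (suc i)))

xorFin-false : ∀ {m} (f : Fin m → Bool) → (∀ i → f i ≡ false) → xorFin f ≡ false
xorFin-false {zero} f h = refl
xorFin-false {suc m} f h rewrite h zero = xorFin-false (λ i → f (suc i)) (λ i → h (suc i))

xorFin-xor : ∀ {m} (f g : Fin m → Bool) → xorFin (λ i → f i xor g i) ≡ xorFin f xor xorFin g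
xorFin-xor {zero} f g = refl
xorFin-xor {suc m} f g =
  trans (cong ((f zero xor g zero) xor_) (xorFin-xor (λ i → f (suc i)) (λ i → g (suc i))))
        (xor-interchange (f zero) (g zero) _ _)

xorFin-single : ∀ {m} (f : Fin m → Bool) (i : Fin m) → (∀ j → j ≢ i → f j ≡ false) → xorFin f ≡ f i
xorFin-single {suc m} f zero h =
  trans (cong (f zero xor_) (xorFin-false _ (λ j → h (suc j) (λ ())))) (xor-identityʳ _)
xorFin-single {suc m} f (suc i) h rewrite h zero (λ ()) =
  xorFin-single (λ j → f (suc j)) i (λ j j≢i → h (suc j) (λ e → j≢i (suc-injective e)))

xorFin-true : ∀ {m} (f : Fin m → Bool) → xorFin f ≡ true → ∃ λ i → f i ≡ true
xorFin-true {suc m} f h with f zero in e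
... | true = zero , e
... | false with xorFin-true (λ i → f (suc i)) h
... | i , q = suc i , q

xorFin-swap : ∀ {m k} (F : Fin m → Fin k → Bool) →
  xorFin (λ i → xorFin (λ j → F i j)) ≡ xorFin (λ j → xorFin (λ i → F i j))
xorFin-swap {zero} {k} F = ≡-sym (xorFin-false {k} _ (λ j → refl))
xorFin-swap {suc m} F = trans (cong (xorFin (F zero) xor_) (xorFin-swap (λ i → F (suc i))))
  (≡-sym (xorFin-xor (F zero) (λ j → xorFin (λ i → F (suc i) j))))

indicator : Bool → ℕ
indicator b = if b then 1 else 0

countFin-cong : ∀ {m} {f g : Fin m → Bool} → (∀ i → f i ≡ g i) → countFin f ≡ countFin g
countFin-cong {zero} h = refl
countFin-cong {suc m} h = cong₂ (λ a b → indicator a + b) (h zero) (countFin-cong (λ i → h (suc i)))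

countFin-false : ∀ {m} (f : Fin m → Bool) → (∀ i → f i ≡ false) → countFin f ≡ 0
countFin-false {zero} f h = refl
countFin-false {suc m} f h rewrite h zero = countFin-false (λ i → f (suc i)) (λ i → h (suc i))

countFin-true : ∀ {m} (f : Fin m → Bool) → (∀ i → f i ≡ true) → countFin f ≡ m
countFin-true {zero} f h = refl
countFin-true {suc m} f h rewrite h zero = cong suc (countFin-true (λ i → f (suc i)) (λ i → h (suc i)))

countFin-drop : ∀ {m} (f g : Fin m → Bool) (i : Fin m) → f i ≡ true → g i ≡ false →
  (∀ j → j ≢ i → g j ≡ f j) → countFin f ≡ suc (countFin g)
countFin-drop {suc m} f g zero fi gi h rewrite fi | gi =
  cong suc (countFin-cong (λ j → ≡-sym (h (suc j) (λ ()))))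
countFin-drop {suc m} f g (suc i) fi gi h rewrite h zero (λ ()) =
  trans (cong (indicator (f zero) +_)
          (countFin-drop (λ j → f (suc j)) (λ j → g (suc j)) i fi gi
            (λ j j≢i → h (suc j) (λ e → j≢i (suc-injective e)))))
        (ℕ.+-suc (indicator (f zero)) _)

countFin-∨+∧ : ∀ {m} (f g : Fin m → Bool) →
  countFin (λ i → f i ∨ g i) + countFin (λ i → f i ∧ g i) ≡ countFin f + countFin g
countFin-∨+∧ {zero} f g = refl
countFin-∨+∧ {suc m} f g =
  trans (interchange₊ (indicator (f zero ∨ g zero)) _ (indicator (f zero ∧ g zero)) _)
  (trans (cong₂ _+_ (indicator-∨+∧ (f zero) (g zero)) (countFin-∨+∧ (λ i → f (suc i)) (λ i → g (suc i))))
         (interchange₊ (indicator (f zero)) (indicator (g zero)) _ _))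
  where
  interchange₊ : ∀ (a b c d : ℕ) → (a + b) + (c + d) ≡ (a + c) + (b + d)
  interchange₊ = solve-∀
  indicator-∨+∧ : ∀ a b → indicator (a ∨ b) + indicator (a ∧ b) ≡ indicator a + indicator b
  indicator-∨+∧ false b = ℕ.+-identityʳ _
  indicator-∨+∧ true false = refl
  indicator-∨+∧ true true = refl

search : ∀ {m} (P : Fin m → Bool) → (∃ λ i → P i ≡ true) ⊎ (∀ i → P i ≡ false)
search {zero} P = inj₂ (λ ())
search {suc m} P with P zero in e
... | true = inj₁ (zero , e)
... | false with search (λ i → P (suc i))
... | inj₁ (i , q) = inj₁ (suc i , q)
... | inj₂ h = inj₂ λ { zero → e ; (suc i) → h i }

xorKind : (Kind → Bool) → Bool
xorKind g = g φ xor (g χ xor g ψ)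

searchW : ∀ {n} (P : W n → Bool) → (∃ λ x → P x ≡ true) ⊎ (∀ x → P x ≡ false)
searchW P with search (λ v → P (v , φ)) | search (λ v → P (v , χ)) | search (λ v → P (v , ψ))
... | inj₁ (v , q) | _ | _ = inj₁ ((v , φ) , q)
... | inj₂ _ | inj₁ (v , q) | _ = inj₁ ((v , χ) , q)
... | inj₂ _ | inj₂ _ | inj₁ (v , q) = inj₁ ((v , ψ) , q)
... | inj₂ h₁ | inj₂ h₂ | inj₂ h₃ = inj₂ λ { (v , φ) → h₁ v ; (v , χ) → h₂ v ; (v , ψ) → h₃ v }

xorW-cong : ∀ {n} {f g : W n → Bool} → (∀ x → f x ≡ g x) → xorW f ≡ xorW g
xorW-cong h = xorFin-cong (λ v → cong₂ _xor_ (h (v , φ)) (cong₂ _xor_ (h (v , χ)) (h (v , ψ))))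

xorW-false : ∀ {n} (f : W n → Bool) → (∀ x → f x ≡ false) → xorW f ≡ false
xorW-false {n} f h = trans (xorW-cong h) (xorFin-false {n} _ (λ _ → refl))

xorW-xor : ∀ {n} (f g : W n → Bool) → xorW (λ x → f x xor g x) ≡ xorW f xor xorW g
xorW-xor f g = trans (xorFin-cong λ v → xorKind-xor (λ k → f (v , k)) (λ k → g (v , k)))
  (xorFin-xor (λ v → xorKind (λ k → f (v , k))) (λ v → xorKind (λ k → g (v , k))))
  where
  xorKind-xor : ∀ a b → xorKind (λ k → a k xor b k) ≡ xorKind a xor xorKind b
  xorKind-xor a b = trans (cong ((a φ xor b φ) xor_) (xor-interchange (a χ) (b χ) (a ψ) (b ψ)))
                          (xor-interchange (a φ) (b φ) (a χ xor a ψ) (b χ xor b ψ))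

xorW-∧ˡ : ∀ {n} b (f : W n → Bool) → xorW (λ x → b ∧ f x) ≡ b ∧ xorW f
xorW-∧ˡ true f = refl
xorW-∧ˡ {n} false f = xorW-false {n} (λ _ → false) (λ _ → refl)

xorW-∧ʳ : ∀ {n} (f : W n → Bool) b → xorW (λ x → f x ∧ b) ≡ xorW f ∧ b
xorW-∧ʳ f b = trans (xorW-cong (λ x → ∧-comm (f x) b)) (trans (xorW-∧ˡ b f) (∧-comm b (xorW f)))

xorW-true : ∀ {n} (f : W n → Bool) → xorW f ≡ true → ∃ λ x → f x ≡ true
xorW-true f h with xorFin-true _ h
... | v , q with f (v , φ) in e₁ | f (v , χ) in e₂ | f (v , ψ) in e₃ | q
... | true | _ | _ | _ = (v , φ) , e₁
... | false | true | _ | _ = (v , χ) , e₂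
... | false | false | true | _ = (v , ψ) , e₃
... | false | false | false | ()

xorW-swap : ∀ {n} (F : W n → W n → Bool) →
  xorW (λ x → xorW (λ y → F x y)) ≡ xorW (λ y → xorW (λ x → F x y))
xorW-swap F =
  trans (double F)
  (trans (xorFin-cong (λ v → xorFin-cong (λ w → xorKind-swap (λ k l → F (v , k) (w , l)))))
  (trans (xorFin-swap (λ v w → xorKind (λ l → xorKind (λ k → F (v , k) (w , l)))))
         (≡-sym (double (λ y x → F x y)))))
  where
  xorKind-xorFin : ∀ {m} (h : Kind → Fin m → Bool) →
    xorKind (λ k → xorFin (h k)) ≡ xorFin (λ w → xorKind (λ k → h k w))
  xorKind-xorFin h = ≡-sym (trans (xorFin-xor (h φ) (λ w → h χ w xor h ψ w))
                                  (cong (xorFin (h φ) xor_) (xorFin-xor (h χ) (h ψ))))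
  double : ∀ {n} (F : W n → W n → Bool) → xorW (λ x → xorW (λ y → F x y)) ≡
    xorFin (λ v → xorFin (λ w → xorKind (λ k → xorKind (λ l → F (v , k) (w , l)))))
  double F = xorFin-cong (λ v → xorKind-xorFin (λ k w → xorKind (λ l → F (v , k) (w , l))))
  xorKind-swap : (g : Kind → Kind → Bool) →
    xorKind (λ k → xorKind (λ l → g k l)) ≡ xorKind (λ l → xorKind (λ k → g k l))
  xorKind-swap g =
    trans (cong (xorKind (g φ) xor_)
            (trans (xor-interchange (g χ φ) _ (g ψ φ) _)
                   (cong ((g χ φ xor g ψ φ) xor_) (xor-interchange (g χ χ) (g χ ψ) (g ψ χ) (g ψ ψ)))))
          (trans (xor-interchange (g φ φ) _ (g χ φ xor g ψ φ) _)
                 (cong ((g φ φ xor (g χ φ xor g ψ φ)) xor_)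
                       (xor-interchange (g φ χ) (g φ ψ) (g χ χ xor g ψ χ) (g χ ψ xor g ψ ψ))))

_≟K_ : (k l : Kind) → Dec (k ≡ l)
φ ≟K φ = yes refl
χ ≟K χ = yes refl
ψ ≟K ψ = yes refl
φ ≟K χ = no λ ()
φ ≟K ψ = no λ ()
χ ≟K φ = no λ ()
χ ≟K ψ = no λ ()
ψ ≟K φ = no λ ()
ψ ≟K χ = no λ ()

_≟W_ : ∀ {n} (x y : W n) → Dec (x ≡ y)
(v , k) ≟W (w , l) with v ≟ w | k ≟K l
... | yes refl | yes refl = yes refl
... | no v≢w | _ = no λ e → v≢w (cong proj₁ e)
... | yes _ | no k≢l = no λ e → k≢l (cong proj₂ e)

｛_｝ : ∀ {n} → W n → Subset n
｛ x ｝ y = does (x ≟W y)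

｛｝-self : ∀ {n} (x : W n) → ｛ x ｝ x ≡ true
｛｝-self x with x ≟W x
... | yes _ = refl
... | no x≢x = ⊥-elim (x≢x refl)

｛｝-other : ∀ {n} {x y : W n} → x ≢ y → ｛ x ｝ y ≡ false
｛｝-other {x = x} {y} x≢y with x ≟W y
... | yes e = ⊥-elim (x≢y e)
... | no _ = refl

｛｝-true : ∀ {n} {x y : W n} → ｛ x ｝ y ≡ true → x ≡ y
｛｝-true {x = x} {y} h with x ≟W y
... | yes e = e

｛｝-false : ∀ {n} {x y : W n} → ｛ x ｝ y ≡ false → x ≢ y
｛｝-false {x = x} h refl = true≢false (trans (≡-sym (｛｝-self x)) h)

δ-refl : ∀ {n} (v : Fin n) → δ v v ≡ true
δ-refl v with v ≟ v
... | yes _ = refl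
... | no v≢v = ⊥-elim (v≢v refl)

δ-≢ : ∀ {n} {v w : Fin n} → v ≢ w → δ v w ≡ false
δ-≢ {v = v} {w} v≢w with v ≟ w
... | yes e = ⊥-elim (v≢w e)
... | no _ = refl

δ-true : ∀ {n} {v w : Fin n} → δ v w ≡ true → v ≡ w
δ-true {v = v} {w} h with v ≟ w
... | yes e = e

δ-false : ∀ {n} {v w : Fin n} → δ v w ≡ false → v ≢ w
δ-false {v = v} h refl = true≢false (trans (≡-sym (δ-refl v)) h)

xorW-single : ∀ {n} (f : W n → Bool) (x : W n) → (∀ y → y ≢ x → f y ≡ false) → xorW f ≡ f x
xorW-single f (v , k) h =
  trans (xorFin-single _ v (λ w w≢v → xorW-cell-false w (λ l e → w≢v (cong proj₁ e))))
        (xorKind-single k (λ l l≢k → h (v , l) (λ e → l≢k (cong proj₂ e))))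
  where
  xorW-cell-false : ∀ w → (∀ l → (w , l) ≢ (v , k)) → xorKind (λ l → f (w , l)) ≡ false
  xorW-cell-false w ne rewrite h (w , φ) (ne φ) | h (w , χ) (ne χ) | h (w , ψ) (ne ψ) = refl
  xorKind-single : ∀ k → (∀ l → l ≢ k → f (v , l) ≡ false) → xorKind (λ l → f (v , l)) ≡ f (v , k)
  xorKind-single φ h' rewrite h' χ (λ ()) | h' ψ (λ ()) = xor-identityʳ _
  xorKind-single χ h' rewrite h' φ (λ ()) | h' ψ (λ ()) = xor-identityʳ _
  xorKind-single ψ h' rewrite h' φ (λ ()) | h' χ (λ ()) = refl

∣∣-cong : ∀ {n} {S T : Subset n} → (∀ x → S x ≡ T x) → ∣ S ∣ ≡ ∣ T ∣
∣∣-cong h = cong₂ _+_ (countFin-cong (λ v → h (v , φ)))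
              (cong₂ _+_ (countFin-cong (λ v → h (v , χ))) (countFin-cong (λ v → h (v , ψ))))

∣∣-false : ∀ {n} (S : Subset n) → (∀ x → S x ≡ false) → ∣ S ∣ ≡ 0
∣∣-false S h rewrite countFin-false _ (λ v → h (v , φ)) | countFin-false _ (λ v → h (v , χ))
                   | countFin-false _ (λ v → h (v , ψ)) = refl

∣∣-drop : ∀ {n} (S T : Subset n) (x : W n) → S x ≡ true → T x ≡ false →
  (∀ y → y ≢ x → T y ≡ S y) → ∣ S ∣ ≡ suc ∣ T ∣
∣∣-drop S T (v , φ) sx tx h =
  cong₂ _+_ (countFin-drop _ _ v sx tx (λ j j≢v → h (j , φ) (λ e → j≢v (cong proj₁ e))))
    (cong₂ _+_ (countFin-cong (λ j → ≡-sym (h (j , χ) (λ ())))) (countFin-cong (λ j → ≡-sym (h (j , ψ) (λ ())))))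
∣∣-drop S T (v , χ) sx tx h =
  trans (cong₂ _+_ (countFin-cong (λ j → ≡-sym (h (j , φ) (λ ()))))
    (cong₂ _+_ (countFin-drop _ _ v sx tx (λ j j≢v → h (j , χ) (λ e → j≢v (cong proj₁ e))))
       (countFin-cong (λ j → ≡-sym (h (j , ψ) (λ ()))))))
  (ℕ.+-suc _ _)
∣∣-drop S T (v , ψ) sx tx h =
  trans (cong₂ _+_ (countFin-cong (λ j → ≡-sym (h (j , φ) (λ ()))))
    (cong₂ _+_ (countFin-cong (λ j → ≡-sym (h (j , χ) (λ ()))))
       (countFin-drop _ _ v sx tx (λ j j≢v → h (j , ψ) (λ e → j≢v (cong proj₁ e))))))
  (trans (cong (countFin (λ j → T (j , φ)) +_) (ℕ.+-suc _ _)) (ℕ.+-suc _ _))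

∣∣-∨+∧ : ∀ {n} (S T : Subset n) → ∣ (λ x → S x ∨ T x) ∣ + ∣ (λ x → S x ∧ T x) ∣ ≡ ∣ S ∣ + ∣ T ∣
∣∣-∨+∧ S T =
  trans (regroup (c S∨T φ) (c S∨T χ) (c S∨T ψ) (c S∧T φ) (c S∧T χ) (c S∧T ψ))
  (trans (cong₂ _+_ (countFin-∨+∧ (λ v → S (v , φ)) (λ v → T (v , φ)))
           (cong₂ _+_ (countFin-∨+∧ (λ v → S (v , χ)) (λ v → T (v , χ)))
                      (countFin-∨+∧ (λ v → S (v , ψ)) (λ v → T (v , ψ)))))
    (≡-sym (regroup (c S φ) (c S χ) (c S ψ) (c T φ) (c T χ) (c T ψ))))
  where
  c : Subset _ → Kind → ℕ
  c U k = countFin (λ v → U (v , k))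
  S∨T S∧T : Subset _
  S∨T x = S x ∨ T x
  S∧T x = S x ∧ T x
  regroup : ∀ (a b c d e f : ℕ) → (a + (b + c)) + (d + (e + f)) ≡ (a + d) + ((b + e) + (c + f))
  regroup = solve-∀

∣｛｝∣ : ∀ {n} (x : W n) → ∣ ｛ x ｝ ∣ ≡ 1
∣｛｝∣ {n} x = trans (∣∣-drop ｛ x ｝ (λ _ → false) x (｛｝-self x) refl
                  (λ y y≢x → ≡-sym (｛｝-other (λ e → y≢x (≡-sym e))))) (cong suc (∣∣-false {n} (λ _ → false) (λ _ → refl)))

_∪_ : ∀ {n} → Subset n → Subset n → Subset n
(A ∪ B) x = A x ∨ B x

∣∣-disjoint-∪ : ∀ {n} (A B : Subset n) → (∀ x → A x ∧ B x ≡ false) → ∣ A ∪ B ∣ ≡ ∣ A ∣ + ∣ B ∣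
∣∣-disjoint-∪ A B h =
  trans (≡-sym (ℕ.+-identityʳ _)) (trans (cong (∣ A ∪ B ∣ +_) (≡-sym (∣∣-false _ h))) (∣∣-∨+∧ A B))

pair : ∀ {n} → W n → W n → Subset n
pair x y z = ｛ x ｝ z xor ｛ y ｝ z

pair-member : ∀ {n} (x y : W n) {z : W n} → pair x y z ≡ true → (z ≡ x) ⊎ (z ≡ y)
pair-member x y {z} e with xor-true {｛ x ｝ z} e
... | inj₁ q = inj₁ (≡-sym (｛｝-true q))
... | inj₂ q = inj₂ (≡-sym (｛｝-true q))

pair-left : ∀ {n} {x y : W n} → x ≢ y → pair x y x ≡ true
pair-left {x = x} x≢y = cong₂ _xor_ (｛｝-self x) (｛｝-other (λ e → x≢y (≡-sym e)))

pair-right : ∀ {n} {x y : W n} → x ≢ y → pair x y y ≡ true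
pair-right {y = y} x≢y = cong₂ _xor_ (｛｝-other x≢y) (｛｝-self y)

pair-outside : ∀ {n} {x y z : W n} → z ≢ x → z ≢ y → pair x y z ≡ false
pair-outside z≢x z≢y = cong₂ _xor_ (｛｝-other (λ e → z≢x (≡-sym e))) (｛｝-other (λ e → z≢y (≡-sym e)))

_─_ : ∀ {n} → Subset n → W n → Subset n
(S ─ x) y = S y ∧ not (｛ x ｝ y)

─-⊆ : ∀ {n} {S : Subset n} {x y} → (S ─ x) y ≡ true → S y ≡ true
─-⊆ {S = S} {y = y} h = ∧-trueˡ {S y} h

─-≢ : ∀ {n} {S : Subset n} {x y} → (S ─ x) y ≡ true → x ≢ y
─-≢ {S = S} {y = y} h = ｛｝-false (not-true (∧-trueʳ {S y} h))

─-intro : ∀ {n} {S : Subset n} {x y} → S y ≡ true → x ≢ y → (S ─ x) y ≡ true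
─-intro sy x≢y = ∧-true sy (false⇒not-true (｛｝-other x≢y))

─-self : ∀ {n} (S : Subset n) x → (S ─ x) x ≡ false
─-self S x = trans (cong (λ b → S x ∧ not b) (｛｝-self x)) (∧-zeroʳ _)

∣∣-─ : ∀ {n} (S : Subset n) (x : W n) → S x ≡ true → ∣ S ∣ ≡ suc ∣ S ─ x ∣
∣∣-─ S x sx = ∣∣-drop S (S ─ x) x sx (─-self S x)
  (λ y y≢x → trans (cong (λ b → S y ∧ not b) (｛｝-other (λ e → y≢x (≡-sym e)))) (∧-identityʳ _))

∣∣-suc : ∀ {n} (S : Subset n) {k} → ∣ S ∣ ≡ suc k → ∃ λ x → S x ≡ true
∣∣-suc S h with searchW S
... | inj₁ p = p
... | inj₂ none with trans (≡-sym h) (∣∣-false S none)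
... | ()

∣∣-zero : ∀ {n} (S : Subset n) → ∣ S ∣ ≡ 0 → ∀ x → S x ≡ false
∣∣-zero S h x with S x in e
... | false = refl
... | true with trans (≡-sym h) (∣∣-─ S x e)
... | ()

-- Linear algebra over GF(2)

Vector : ℕ → Set
Vector m = Fin m → Bool

Nonzero : ∀ {m} → Vector m → Set
Nonzero p = ∃ λ u → p u ≡ true

combination : ∀ {n m} → (W n → Vector m) → Subset n → Vector m
combination f U u = xorW (λ x → U x ∧ f x u)

LinDependent : ∀ {n m} → (W n → Vector m) → Subset n → Set
LinDependent {n} f T =
  Σ (Subset n) λ U → (U ⊆ T) × (∃ λ x → U x ≡ true) × (∀ u → combination f U u ≡ false)

LinIndependent : ∀ {n m} → (W n → Vector m) → Subset n → Set
LinIndependent f T = ¬ LinDependent f T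

Represents : ∀ {n m} → (W n → Vector m) → Subset n → Subset n → Vector m → Set
Represents f T U v = (U ⊆ T) × (∀ u → combination f U u ≡ v u)

Span : ∀ {n m} → (W n → Vector m) → Subset n → Vector m → Set
Span {n} f T v = Σ (Subset n) λ U → Represents f T U v

choose : ∀ {n} (T : Subset n) (P : W n → Subset n → Set) → (∀ x → T x ≡ true → Σ (Subset n) (P x)) →
  Σ (W n → Subset n) λ U → ∀ x → T x ≡ true → P x (U x)
choose {n} T P h = (λ x → pick x (T x) refl) , λ x tx → pick-correct x (T x) refl tx
  where
  pick : ∀ x b → T x ≡ b → Subset n
  pick x true e = proj₁ (h x e)
  pick x false e = λ _ → false
  pick-correct : ∀ x b (e : T x ≡ b) → b ≡ true → P x (pick x b e)
  pick-correct x true e _ = proj₂ (h x e)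

module _ {n m : ℕ} where

  combination-cong : (f : W n → Vector m) {U U′ : Subset n} → (∀ x → U x ≡ U′ x) →
    ∀ u → combination f U u ≡ combination f U′ u
  combination-cong f h u = xorW-cong (λ x → cong (_∧ f x u) (h x))

  combination-congᶠ : (f g : W n → Vector m) (U : Subset n) → (∀ x → U x ≡ true → ∀ u → f x u ≡ g x u) →
    ∀ u → combination f U u ≡ combination g U u
  combination-congᶠ f g U h u = xorW-cong pointwise
    where
    pointwise : ∀ x → U x ∧ f x u ≡ U x ∧ g x u
    pointwise x with U x in e
    ... | true = h x e u
    ... | false = refl

  combination-∅ : (f : W n → Vector m) (U : Subset n) → (∀ x → U x ≡ false) → ∀ u → combination f U u ≡ false
  combination-∅ f U h u = xorW-false _ (λ x → cong (_∧ f x u) (h x))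

  combination-xor : (f : W n → Vector m) (U U′ : Subset n) → ∀ u →
    combination f (λ x → U x xor U′ x) u ≡ combination f U u xor combination f U′ u
  combination-xor f U U′ u = trans (xorW-cong (λ x → ∧-distribʳ-xor (f x u) (U x) (U′ x)))
    (xorW-xor (λ x → U x ∧ f x u) (λ x → U′ x ∧ f x u))

  combination-∧ : (f : W n → Vector m) (b : Bool) (U : Subset n) → ∀ u →
    combination f (λ x → b ∧ U x) u ≡ b ∧ combination f U u
  combination-∧ f b U u = trans (xorW-cong (λ x → ∧-assoc b (U x) (f x u))) (xorW-∧ˡ b (λ x → U x ∧ f x u))

  combination-｛｝ : (f : W n → Vector m) (x : W n) → ∀ u → combination f ｛ x ｝ u ≡ f x u
  combination-｛｝ f x u =
    trans (xorW-single (λ y → ｛ x ｝ y ∧ f y u) x (λ y y≢x → cong (_∧ f y u) (｛｝-other (λ e → y≢x (≡-sym e)))))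
          (cong (_∧ f x u) (｛｝-self x))

  combination-xorᶠ : (f g : W n → Vector m) (U : Subset n) → ∀ u →
    combination (λ x v → f x v xor g x v) U u ≡ combination f U u xor combination g U u
  combination-xorᶠ f g U u = trans (xorW-cong (λ x → ∧-distribˡ-xor (U x) (f x u) (g x u)))
    (xorW-xor (λ x → U x ∧ f x u) (λ x → U x ∧ g x u))

  combination-scaled : (c : W n → Bool) (h : Vector m) (U : Subset n) → ∀ u →
    combination (λ x v → c x ∧ h v) U u ≡ xorW (λ x → U x ∧ c x) ∧ h u
  combination-scaled c h U u =
    trans (xorW-cong (λ x → ≡-sym (∧-assoc (U x) (c x) (h u)))) (xorW-∧ʳ (λ x → U x ∧ c x) (h u))

  combination-split : (f : W n → Vector m) (U : Subset n) (s : W n) → ∀ u →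
    combination f U u ≡ (U s ∧ f s u) xor combination f (U ─ s) u
  combination-split f U s u =
    trans (combination-cong f (λ x → split (U x) (｛ s ｝ x)) u)
    (trans (combination-xor f (λ x → U x ∧ ｛ s ｝ x) (U ─ s) u)
           (cong (_xor combination f (U ─ s) u) at-s))
    where
    split : ∀ a e → a ≡ (a ∧ e) xor (a ∧ not e)
    split false e = refl
    split true false = refl
    split true true = refl
    restrict : ∀ x → U x ∧ ｛ s ｝ x ≡ U s ∧ ｛ s ｝ x
    restrict x with s ≟W x
    ... | yes refl = refl
    ... | no _ = trans (∧-zeroʳ (U x)) (≡-sym (∧-zeroʳ (U s)))
    at-s : combination f (λ x → U x ∧ ｛ s ｝ x) u ≡ U s ∧ f s u
    at-s = trans (combination-cong f restrict u)
                 (trans (combination-∧ f (U s) ｛ s ｝ u) (cong (U s ∧_) (combination-｛｝ f s u)))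

  span-∈ : (f : W n → Vector m) (T : Subset n) (x : W n) → T x ≡ true → Span f T (f x)
  span-∈ f T x tx = ｛ x ｝ , (λ y e → subst (λ z → T z ≡ true) (｛｝-true e) tx) , combination-｛｝ f x

  span-zero : (f : W n → Vector m) (T : Subset n) → Span f T (λ _ → false)
  span-zero f T = (λ _ → false) , (λ y ()) , combination-∅ f (λ _ → false) (λ _ → refl)

  span-xor : (f : W n → Vector m) (T : Subset n) {v w : Vector m} → Span f T v → Span f T w →
    Span f T (λ u → v u xor w u)
  span-xor f T (U , U⊆ , eU) (U′ , U′⊆ , eU′) =
    (λ x → U x xor U′ x) , (λ x e → [ U⊆ x , U′⊆ x ]′ (xor-true e)) ,
    (λ u → trans (combination-xor f U U′ u) (cong₂ _xor_ (eU u) (eU′ u)))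

  span-mono : (f : W n → Vector m) {T T′ : Subset n} → T ⊆ T′ → {v : Vector m} → Span f T v → Span f T′ v
  span-mono f T⊆ (U , U⊆ , eU) = U , (λ x e → T⊆ x (U⊆ x e)) , eU

  span-cong : (f : W n → Vector m) (T : Subset n) {v w : Vector m} → (∀ u → v u ≡ w u) → Span f T v → Span f T w
  span-cong f T h (U , U⊆ , eU) = U , U⊆ , (λ u → trans (eU u) (h u))

  span-trans : (g h : W n → Vector m) (S S′ : Subset n) → (∀ y → S y ≡ true → Span h S′ (g y)) →
    {v : Vector m} → Span g S v → Span h S′ v
  span-trans g h S S′ hg {v} (U , U⊆ , eU) = U′ , U′⊆ , eq
    where
    witnesses = choose S (λ y Vy → (Vy ⊆ S′) × (∀ u → combination h Vy u ≡ g y u)) hg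
    Vf = proj₁ witnesses
    Vf-correct = proj₂ witnesses
    U′ : Subset n
    U′ z = xorW (λ y → U y ∧ Vf y z)
    U′⊆ : U′ ⊆ S′
    U′⊆ z e with xorW-true _ e
    ... | y , q = proj₁ (Vf-correct y (U⊆ y (∧-trueˡ q))) z (∧-trueʳ q)
    expand : ∀ u y → U y ∧ combination h (Vf y) u ≡ U y ∧ g y u
    expand u y with U y in e
    ... | true = proj₂ (Vf-correct y (U⊆ y e)) u
    ... | false = refl
    eq : ∀ u → combination h U′ u ≡ v u
    eq u = trans (xorW-cong (λ z → ≡-sym (xorW-∧ʳ (λ y → U y ∧ Vf y z) (h z u))))
      (trans (xorW-swap (λ z y → (U y ∧ Vf y z) ∧ h z u))
      (trans (xorW-cong (λ y → trans (xorW-cong (λ z → ∧-assoc (U y) (Vf y z) (h z u)))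
                                     (xorW-∧ˡ (U y) (λ z → Vf y z ∧ h z u))))
      (trans (xorW-cong (expand u)) (eU u))))

update : ∀ {n m} → (W n → Vector m) → W n → Vector m → W n → Vector m
update g t p y = if ｛ t ｝ y then p else g y

module _ {n m : ℕ} where

  update-self : (g : W n → Vector m) (t : W n) (p : Vector m) → ∀ u → update g t p t u ≡ p u
  update-self g t p u = cong (λ b → (if b then p else g t) u) (｛｝-self t)

  update-other : (g : W n → Vector m) {t y : W n} (p : Vector m) → t ≢ y → ∀ u → update g t p y u ≡ g y u
  update-other g {y = y} p t≢y u = cong (λ b → (if b then p else g y) u) (｛｝-other t≢y)

  exchange : (g : W n → Vector m) (T A : Subset n) (t : W n) → A ⊆ T → A t ≡ true → (p : Vector m) →
    (∀ u → combination g A u ≡ p u) → ∀ y → T y ≡ true → Span (update g t p) T (g y)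
  exchange g T A t A⊆T at p eA y ty with t ≟W y
  ... | no t≢y = span-cong (update g t p) T (update-other g p t≢y) (span-∈ (update g t p) T y ty)
  ... | yes refl = A , A⊆T , eq
    where
    g′ = update g t p
    r : Vector m
    r = combination g (A ─ t)
    eq : ∀ u → combination g′ A u ≡ g t u
    eq u = begin
      combination g′ A u                     ≡⟨ combination-split g′ A t u ⟩
      (A t ∧ g′ t u) xor combination g′ (A ─ t) u
        ≡⟨ cong₂ (λ a b → (a ∧ b) xor combination g′ (A ─ t) u) at (update-self g t p u) ⟩
      p u xor combination g′ (A ─ t) u
        ≡⟨ cong (p u xor_) (combination-congᶠ g′ g (A ─ t) (λ x e → update-other g p (─-≢ {S = A} {t} e)) u) ⟩
      p u xor r u                            ≡⟨ cong (_xor r u) (≡-sym (eA u)) ⟩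
      combination g A u xor r u              ≡⟨ cong (_xor r u) (combination-split g A t u) ⟩
      ((A t ∧ g t u) xor r u) xor r u        ≡⟨ cong (λ a → ((a ∧ g t u) xor r u) xor r u) at ⟩
      (g t u xor r u) xor r u                ≡⟨ xor-cancelʳ (g t u) (r u) ⟩
      g t u                                  ∎
      where open ≡-Reasoning

  update-span : (g h : W n → Vector m) (T Z : Subset n) (t : W n) {p : Vector m} →
    (∀ y → T y ≡ true → t ≢ y → Span h Z (g y)) → Span h Z p →
    ∀ y → T y ≡ true → Span h Z (update g t p y)
  update-span g h T Z t hg hp y ty with t ≟W y
  ... | yes refl = hp
  ... | no t≢y = hg y ty t≢y

independent-shear : ∀ {n m} (f : W n → Vector m) (T : Subset n) (x₀ : W n) (c : W n → Bool) →
  T x₀ ≡ true → LinIndependent f T → LinIndependent (λ x u → f x u xor (c x ∧ f x₀ u)) (T ─ x₀)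
independent-shear {n} f T x₀ c tx₀ ind (R , R⊆ , (y , ry) , eR) = ind (R′ , R′⊆ , (y , ry′) , eR′)
  where
  b = xorW (λ x → R x ∧ c x)
  R′ : Subset n
  R′ x = R x xor (b ∧ ｛ x₀ ｝ x)
  R′⊆ : R′ ⊆ T
  R′⊆ x e with xor-true {R x} e
  ... | inj₁ q = ─-⊆ {S = T} {x₀} (R⊆ x q)
  ... | inj₂ q = subst (λ z → T z ≡ true) (｛｝-true (∧-trueʳ {b} q)) tx₀
  ry′ : R′ y ≡ true
  ry′ = trans (cong (λ z → R y xor (b ∧ z)) (｛｝-other (─-≢ {S = T} {x₀} (R⊆ y ry))))
              (trans (cong (R y xor_) (∧-zeroʳ b)) (trans (xor-identityʳ (R y)) ry))
  eR′ : ∀ u → combination f R′ u ≡ false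
  eR′ u = trans (combination-xor f R (λ x → b ∧ ｛ x₀ ｝ x) u)
    (trans (cong (combination f R u xor_) (trans (combination-∧ f b ｛ x₀ ｝ u) (cong (b ∧_) (combination-｛｝ f x₀ u))))
    (trans (cong (combination f R u xor_) (≡-sym (combination-scaled c (f x₀) R u)))
    (trans (≡-sym (combination-xorᶠ f (λ x v → c x ∧ f x₀ v) R u)) (eR u))))

steinitz : ∀ {n m} k (f g : W n → Vector m) (T S : Subset n) (U : W n → Subset n) → ∣ S ∣ ≡ k →
  LinIndependent f T → (∀ x → T x ≡ true → Represents g S (U x) (f x)) → ∣ T ∣ ≤ k
steinitz zero f g T S U ∣S∣≡0 ind rep = ℕ.≤-reflexive (∣∣-false T T-empty)
  where
  T-empty : ∀ x → T x ≡ false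
  T-empty x with T x in tx
  ... | false = refl
  ... | true = ⊥-elim (ind (｛ x ｝ , (λ y q → subst (λ z → T z ≡ true) (｛｝-true q) tx) , (x , ｛｝-self x) ,
       λ u → trans (combination-｛｝ f x u) (trans (≡-sym (proj₂ (rep x tx) u))
               (combination-∅ g (U x) (λ y → Ux-empty y) u))))
    where
    Ux-empty : ∀ y → U x y ≡ false
    Ux-empty y with U x y in e
    ... | false = refl
    ... | true = ⊥-elim (true≢false (trans (≡-sym (proj₁ (rep x tx) y e)) (∣∣-zero S ∣S∣≡0 y)))
steinitz {n} (suc k) f g T S U ∣S∣≡1+k ind rep with ∣∣-suc S ∣S∣≡1+k
... | s , ss with searchW (λ x → T x ∧ U x s)
... | inj₂ s-unused = ℕ.m≤n⇒m≤1+n (steinitz k f g T (S ─ s) U ∣S─s∣ ind rep′)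
  where
  ∣S─s∣ : ∣ S ─ s ∣ ≡ k
  ∣S─s∣ = ℕ.suc-injective (trans (≡-sym (∣∣-─ S s ss)) ∣S∣≡1+k)
  rep′ : ∀ x → T x ≡ true → Represents g (S ─ s) (U x) (f x)
  rep′ x tx = (λ y uy → ─-intro {S = S} {s} (proj₁ (rep x tx) y uy) (s≢ y uy)) , proj₂ (rep x tx)
    where
    s≢ : ∀ y → U x y ≡ true → s ≢ y
    s≢ y uy refl = true≢false (trans (≡-sym (∧-true tx uy)) (s-unused x))
... | inj₁ (x₀ , p) = subst (_≤ suc k) (≡-sym (∣∣-─ T x₀ tx₀))
        (s≤s (steinitz k f′ g (T ─ x₀) (S ─ s) U′ ∣S─s∣ (independent-shear f T x₀ c tx₀ ind) rep′))
  where
  tx₀ = ∧-trueˡ {T x₀} p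
  c : W n → Bool
  c x = U x s
  cx₀ : c x₀ ≡ true
  cx₀ = ∧-trueʳ {T x₀} p
  ∣S─s∣ : ∣ S ─ s ∣ ≡ k
  ∣S─s∣ = ℕ.suc-injective (trans (≡-sym (∣∣-─ S s ss)) ∣S∣≡1+k)
  f′ : W n → Vector _
  f′ x u = f x u xor (c x ∧ f x₀ u)
  -- Eliminate s from the representation of f x using the representation of f x₀, which uses s.
  U′ : W n → Subset n
  U′ x y = (U x ─ s) y xor (c x ∧ (U x₀ ─ s) y)
  rep′ : ∀ x → (T ─ x₀) x ≡ true → Represents g (S ─ s) (U′ x) (f′ x)
  rep′ x tx′ = U′⊆ , eq
    where
    tx = ─-⊆ {S = T} {x₀} tx′
    U′⊆ : U′ x ⊆ (S ─ s)
    U′⊆ y e with xor-true {(U x ─ s) y} e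
    ... | inj₁ q = ─-intro {S = S} {s} (proj₁ (rep x tx) y (─-⊆ {S = U x} {s} q)) (─-≢ {S = U x} {s} q)
    ... | inj₂ q = ─-intro {S = S} {s} (proj₁ (rep x₀ tx₀) y (─-⊆ {S = U x₀} {s} q₀)) (─-≢ {S = U x₀} {s} q₀)
      where q₀ = ∧-trueʳ {c x} q
    eq : ∀ u → combination g (U′ x) u ≡ f′ x u
    eq u = trans (combination-xor g (U x ─ s) (λ y → c x ∧ (U x₀ ─ s) y) u)
      (trans (cong (combination g (U x ─ s) u xor_) (combination-∧ g (c x) (U x₀ ─ s) u))
      (trans (regroup (c x) (g s u) (combination g (U x ─ s) u) (combination g (U x₀ ─ s) u))
        (cong₂ (λ a b → a xor (c x ∧ b))
          (trans (≡-sym (combination-split g (U x) s u)) (proj₂ (rep x tx) u))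
          (trans (cong (λ z → (z ∧ g s u) xor combination g (U x₀ ─ s) u) (≡-sym cx₀))
            (trans (≡-sym (combination-split g (U x₀) s u)) (proj₂ (rep x₀ tx₀) u))))))
      where
      regroup : ∀ c a r r₀ → r xor (c ∧ r₀) ≡ ((c ∧ a) xor r) xor (c ∧ (a xor r₀))
      regroup false a r r₀ = refl
      regroup true false r r₀ = refl
      regroup true true false r₀ = ≡-sym (𝔹.not-involutive r₀)
      regroup true true true false = refl
      regroup true true true true = refl

independent-≤-spanning : ∀ {n m} (f g : W n → Vector m) (T S : Subset n) → LinIndependent f T →
  (∀ x → T x ≡ true → Span g S (f x)) → ∣ T ∣ ≤ ∣ S ∣
independent-≤-spanning f g T S ind spans =
  steinitz ∣ S ∣ f g T S (proj₁ witnesses) refl ind (proj₂ witnesses)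
  where witnesses = choose T (λ x U → Represents g S U (f x)) spans

¬¬-∀Fin : ∀ {m} (P : Fin m → Set) → (∀ i → ¬ ¬ P i) → ¬ ¬ (∀ i → P i)
¬¬-∀Fin {zero} P h k = k (λ ())
¬¬-∀Fin {suc m} P h k = h zero λ p₀ → ¬¬-∀Fin (λ i → P (suc i)) (λ i → h (suc i))
  λ ps → k λ { zero → p₀ ; (suc i) → ps i }

¬¬-∀W : ∀ {n} (P : W n → Set) → (∀ x → ¬ ¬ P x) → ¬ ¬ (∀ x → P x)
¬¬-∀W P h k = ¬¬-∀Fin (λ v → ∀ l → P (v , l))
  (λ v kv → h (v , φ) λ a → h (v , χ) λ b → h (v , ψ) λ c → kv λ { φ → a ; χ → b ; ψ → c })
  (λ f → k (λ x → f (proj₁ x) (proj₂ x)))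

¬¬-⇒ : (b : Bool) {P : Set} → (b ≡ true → ¬ ¬ P) → ¬ ¬ (b ≡ true → P)
¬¬-⇒ false h k = k (λ ())
¬¬-⇒ true h k = h refl (λ p → k (λ _ → p))

-- Rank and the connectivity function

module Rank {n : ℕ} (G : Graph n) where

  col : W n → Vector n
  col = column G

  Shared : Subset n → Vector n → Set
  Shared S p = Nonzero p × Span col S p × Span col (∁ S) p

  basis⇒IsRank : (S B : Subset n) → B ⊆ S → LinIndependent col B →
    (∀ x → S x ≡ true → Span col B (col x)) → IsRank G S ∣ B ∣
  basis⇒IsRank S B B⊆S indB spans = (B , B⊆S , indB , refl) , maximal
    where
    maximal : ∀ T → T ⊆ S → Independent G T → ∣ T ∣ ≤ ∣ B ∣
    maximal T T⊆S indT = independent-≤-spanning col col T B indT (λ x tx → spans x (T⊆S x tx))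

  -- The independent set witnessing IsRank G S a spans S, but only up to double negation:
  -- a column outside its span would give a larger independent subset of S.
  rank-witness-spans : (S : Subset n) {a : ℕ} (R : IsRank G S a) → ∀ x → S x ≡ true →
    ¬ ¬ Span col (proj₁ (proj₁ R)) (col x)
  rank-witness-spans S {a} ((Ta , Ta⊆ , indA , ∣Ta∣) , maximal) x sx x∉span =
    ℕ.<-irrefl refl (subst (_≤ a) ∣T′∣ (maximal T′ T′⊆ indT′))
    where
    tax : Ta x ≡ false
    tax with Ta x in e
    ... | false = refl
    ... | true = ⊥-elim (x∉span (span-∈ col Ta x e))
    T′ : Subset n
    T′ y = Ta y ∨ ｛ x ｝ y
    T′⊆ : T′ ⊆ S
    T′⊆ y e with Ta y in e₂
    ... | true = Ta⊆ y e₂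
    ... | false = subst (λ z → S z ≡ true) (｛｝-true e) sx
    ⊆Ta : ∀ R → R ⊆ T′ → R x ≡ false → R ⊆ Ta
    ⊆Ta R R⊆ rx z e with Ta z in e₃ | x ≟W z
    ... | true | _ = refl
    ... | false | yes refl = ⊥-elim (true≢false (trans (≡-sym e) rx))
    ... | false | no x≢z = ⊥-elim (true≢false (trans (≡-sym (R⊆ z e)) (cong₂ _∨_ e₃ (｛｝-other x≢z))))
    indT′ : Independent G T′
    indT′ (R , R⊆ , (y , ry) , eR) with R x in rx
    ... | true = x∉span (R ─ x , ⊆Ta (R ─ x) (λ z e → R⊆ z (─-⊆ {S = R} {x} e)) (─-self R x) , eqs)
      where
      eqs : ∀ u → combination col (R ─ x) u ≡ col x u
      eqs u = xor-false (col x u) (combination col (R ─ x) u)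
        (trans (≡-sym (cong (λ z → (z ∧ col x u) xor combination col (R ─ x) u) rx))
          (trans (≡-sym (combination-split col R x u)) (eR u)))
    ... | false = indA (R , ⊆Ta R R⊆ rx , (y , ry) , eR)
    ∣T′∣ : ∣ T′ ∣ ≡ suc a
    ∣T′∣ = trans (∣∣-drop T′ Ta x (trans (cong (Ta x ∨_) (｛｝-self x)) (∨-zeroʳ (Ta x))) tax
       (λ y y≢x → ≡-sym (trans (cong (Ta y ∨_) (｛｝-other (λ e → y≢x (≡-sym e)))) (∨-identityʳ (Ta y)))))
       (cong suc ∣Ta∣)

  record SpanningPair (S : Subset n) : Set where
    field
      Ta Tb : Subset n
      Ta⊆S : Ta ⊆ S
      Tb⊆∁S : Tb ⊆ ∁ S
      spans-S : ∀ x → S x ≡ true → Span col Ta (col x)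
      spans-∁S : ∀ x → ∁ S x ≡ true → Span col Tb (col x)

  module Bound {S : Subset n} (B : SpanningPair S) (Tc : Subset n) (indC : LinIndependent col Tc) where
    open SpanningPair B

    bound-by-spanning : (S′ : Subset n) → S′ ⊆ Ta → (∀ x → Span col (S′ ∪ Tb) (col x)) → ∣ Tc ∣ ≤ ∣ S′ ∣ + ∣ Tb ∣
    bound-by-spanning S′ S′⊆Ta spans =
      subst (∣ Tc ∣ ≤_) (∣∣-disjoint-∪ S′ Tb disjoint) (independent-≤-spanning col col Tc _ indC (λ x _ → spans x))
      where
      disjoint : ∀ y → S′ y ∧ Tb y ≡ false
      disjoint y with S′ y in e₁ | Tb y in e₂
      ... | false | _ = refl
      ... | true | false = refl
      ... | true | true with trans (≡-sym (Tb⊆∁S y e₂)) (cong not (Ta⊆S y (S′⊆Ta y e₁)))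
      ... | ()

    spans-via : (Z : Subset n) (g : W n → Vector n) → Tb ⊆ Z →
      (∀ y → Ta y ≡ true → Span g Ta (col y)) → (∀ y → Ta y ≡ true → Span col Z (g y)) →
      ∀ x → Span col Z (col x)
    spans-via Z g Tb⊆Z col⊆g g⊆Z x with S x in e
    ... | true = span-trans g col Ta Z g⊆Z (span-trans col g Ta Ta col⊆g (spans-S x e))
    ... | false = span-mono col Tb⊆Z (spans-∁S x (false⇒not-true e))

    in-Tb : {p : Vector n} → Span col (∁ S) p → (S′ : Subset n) → Span col (S′ ∪ Tb) p
    in-Tb p∈∁S S′ = span-mono col (λ z → ∨-trueʳ (S′ z)) (span-trans col col (∁ S) Tb spans-∁S p∈∁S)

    record Pivot (p : Vector n) : Set where
      field
        t : W n
        t∈Ta : Ta t ≡ true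
        replaces : ∀ y → Ta y ≡ true → Span (update col t p) Ta (col y)

    -- A nonzero p in the span of S is a combination of Ta using some t; then p may replace t.
    pivot : {p : Vector n} → Nonzero p → Span col S p → Pivot p
    pivot {p} (u₀ , pu₀) p∈S = record { t = t ; t∈Ta = A⊆Ta t at ; replaces = exchange col Ta A t A⊆Ta at p eA }
      where
      p∈Ta : Span col Ta p
      p∈Ta = span-trans col col S Ta spans-S p∈S
      A = proj₁ p∈Ta
      A⊆Ta = proj₁ (proj₂ p∈Ta)
      eA = proj₂ (proj₂ p∈Ta)
      used : ∃ λ t → A t ∧ col t u₀ ≡ true
      used = xorW-true (λ x → A x ∧ col x u₀) (trans (eA u₀) pu₀)
      t = proj₁ used
      at : A t ≡ true
      at = ∧-trueˡ (proj₂ used)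

    shared-bound₁ : {p : Vector n} → Shared S p → suc ∣ Tc ∣ ≤ ∣ Ta ∣ + ∣ Tb ∣
    shared-bound₁ {p} (nz , p∈S , p∈∁S) =
      subst (λ k → suc ∣ Tc ∣ ≤ k + ∣ Tb ∣) (≡-sym (∣∣-─ Ta t t∈Ta))
        (s≤s (bound-by-spanning S′ (λ y → ─-⊆ {S = Ta} {t}) (spans-via (S′ ∪ Tb) (update col t p) (λ z → ∨-trueʳ (S′ z))
           replaces (update-span col col Ta (S′ ∪ Tb) t in-S′ (in-Tb p∈∁S S′)))))
      where
      open Pivot (pivot nz p∈S)
      S′ = Ta ─ t
      in-S′ : ∀ y → Ta y ≡ true → t ≢ y → Span col (S′ ∪ Tb) (col y)
      in-S′ y ty t≢y = span-∈ col (S′ ∪ Tb) y (∨-trueˡ (Tb y) (─-intro {S = Ta} ty t≢y))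

    uses-other : (g : W n → Vector n) (A : Subset n) (t : W n) {p q : Vector n} → (∀ u → g t u ≡ p u) →
      (∀ u → combination g A u ≡ q u) → Nonzero q → (∃ λ u → p u ≢ q u) → ∃ λ t′ → A t′ ≡ true × t ≢ t′
    uses-other g A t {p} {q} gt eA (u₀ , qu₀) (u₁ , p≢q) with searchW (A ─ t)
    ... | inj₁ (t′ , e) = t′ , ─-⊆ {S = A} {t} e , ─-≢ {S = A} {t} e
    ... | inj₂ A⊆｛t｝ = ⊥-elim (only-t (A t) refl)
      where
      sum : ∀ u → combination g A u ≡ (A t ∧ g t u)
      sum u = trans (combination-split g A t u)
        (trans (cong ((A t ∧ g t u) xor_) (combination-∅ g (A ─ t) A⊆｛t｝ u)) (xor-identityʳ _))
      only-t : ∀ b → A t ≡ b → ⊥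
      only-t true at = p≢q (trans (≡-sym (gt u₁)) (trans (cong (_∧ g t u₁) (≡-sym at)) (trans (≡-sym (sum u₁)) (eA u₁))))
      only-t false at = true≢false (trans (≡-sym qu₀) (trans (≡-sym (eA u₀)) (trans (sum u₀) (cong (_∧ g t u₀) at))))

    shared-bound₂ : {p q : Vector n} → Shared S p → Shared S q → (∃ λ u → p u ≢ q u) →
      suc (suc ∣ Tc ∣) ≤ ∣ Ta ∣ + ∣ Tb ∣
    shared-bound₂ {p} {q} (nzp , p∈S , p∈∁S) (nzq , q∈S , q∈∁S) p≢q =
      subst (λ k → suc (suc ∣ Tc ∣) ≤ k + ∣ Tb ∣)
        (≡-sym (trans (∣∣-─ Ta t t∈Ta) (cong suc (∣∣-─ (Ta ─ t) t₂ (─-intro {S = Ta} (A₂⊆Ta t₂ at₂) t≢t₂)))))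
        (s≤s (s≤s (bound-by-spanning S″ (λ y e → ─-⊆ {S = Ta} {t} (─-⊆ {S = Ta ─ t} {t₂} e))
          (spans-via Z g₂ (λ z → ∨-trueʳ (S″ z)) col⊆g₂ g₂⊆Z))))
      where
      open Pivot (pivot nzp p∈S)
      g₁ g₂ : W n → Vector n
      g₁ = update col t p
      q∈Ta : Span g₁ Ta q
      q∈Ta = span-trans col g₁ Ta Ta replaces (span-trans col col S Ta spans-S q∈S)
      A₂ = proj₁ q∈Ta
      A₂⊆Ta = proj₁ (proj₂ q∈Ta)
      eA₂ = proj₂ (proj₂ q∈Ta)
      other = uses-other g₁ A₂ t (update-self col t p) eA₂ nzq p≢q
      t₂ = proj₁ other
      at₂ = proj₁ (proj₂ other)
      t≢t₂ = proj₂ (proj₂ other)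
      g₂ = update g₁ t₂ q
      S″ = (Ta ─ t) ─ t₂
      Z = S″ ∪ Tb
      col⊆g₂ : ∀ y → Ta y ≡ true → Span g₂ Ta (col y)
      col⊆g₂ y ty = span-trans g₁ g₂ Ta Ta (exchange g₁ Ta A₂ t₂ A₂⊆Ta at₂ q eA₂) (replaces y ty)
      in-S″ : ∀ y → (Ta ─ t₂) y ≡ true → t ≢ y → Span col Z (col y)
      in-S″ y ty t≢y = span-∈ col Z y (∨-trueˡ (Tb y)
        (─-intro {S = Ta ─ t} (─-intro {S = Ta} (─-⊆ {S = Ta} {t₂} ty) t≢y) (─-≢ {S = Ta} {t₂} ty)))
      g₂⊆Z : ∀ y → Ta y ≡ true → Span col Z (g₂ y)
      g₂⊆Z = update-span g₁ col Ta Z t₂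
        (λ y ty t₂≢y → update-span col col (Ta ─ t₂) Z t in-S″ (in-Tb p∈∁S S″) y (─-intro {S = Ta} ty t₂≢y))
        (in-Tb q∈∁S S″)

  -- The conclusion is decidable, so the double-negated spanning of the rank witnesses suffices.
  rank-bound : (S : Subset n) (k : ℕ) {a b c : ℕ} → IsRank G S a → IsRank G (∁ S) b → IsRank G full c →
    (∀ (B : SpanningPair S) Tc → LinIndependent col Tc →
       k + ∣ Tc ∣ ≤ ∣ SpanningPair.Ta B ∣ + ∣ SpanningPair.Tb B ∣) →
    k + c ≤ a + b
  rank-bound S k RA@((Ta , Ta⊆S , _ , refl) , _) RB@((Tb , Tb⊆∁S , _ , refl) , _) ((Tc , _ , indC , refl) , _) bound =
    decidable-stable (k + ∣ Tc ∣ ℕ.≤? ∣ Ta ∣ + ∣ Tb ∣) λ ¬bound →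
      ¬¬-∀W (λ x → S x ≡ true → Span col Ta (col x)) (λ x → ¬¬-⇒ (S x) (rank-witness-spans S RA x)) λ spA →
      ¬¬-∀W (λ x → ∁ S x ≡ true → Span col Tb (col x)) (λ x → ¬¬-⇒ (∁ S x) (rank-witness-spans (∁ S) RB x)) λ spB →
      ¬bound (bound (record { Ta = Ta ; Tb = Tb ; Ta⊆S = Ta⊆S ; Tb⊆∁S = Tb⊆∁S ; spans-S = spA ; spans-∁S = spB })
                    Tc indC)

  shared⇒¬λ<1 : (S : Subset n) {p : Vector n} → Shared S p → ¬ LambdaLt G S 1
  shared⇒¬λ<1 S sh (.0 , (a , b , c , RA , RB , RC , a+b≡c) , s≤s z≤n) =
    ℕ.<-irrefl refl (subst (suc c ≤_) a+b≡c (rank-bound S 1 RA RB RC (λ B Tc indC → Bound.shared-bound₁ B Tc indC sh)))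

  shared₂⇒¬λ<2 : (S : Subset n) {p q : Vector n} → Shared S p → Shared S q → (∃ λ u → p u ≢ q u) →
    ¬ LambdaLt G S 2
  shared₂⇒¬λ<2 S shp shq p≢q (l , (a , b , c , RA , RB , RC , a+b≡l+c) , l<2) =
    ℕ.<-irrefl refl (ℕ.≤-trans
      (rank-bound S 2 RA RB RC (λ B Tc indC → Bound.shared-bound₂ B Tc indC shp shq p≢q))
      (subst (_≤ suc c) (≡-sym a+b≡l+c) (ℕ.+-monoˡ-≤ c (ℕ.≤-pred l<2))))

-- The columns of IAS(G)

Φ : ∀ {n} → (Fin n → Bool) → Subset n
Φ P (v , φ) = P v
Φ P (v , χ) = false
Φ P (v , ψ) = false

Φ-non-φ : ∀ {n} (P : Fin n → Bool) y → proj₂ y ≢ φ → Φ P y ≡ false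
Φ-non-φ P (v , φ) y≢φ = ⊥-elim (y≢φ refl)
Φ-non-φ P (v , χ) _ = refl
Φ-non-φ P (v , ψ) _ = refl

Φ-elem : ∀ {n} (P : Fin n → Bool) (R : Subset n) → R ⊆ Φ P → ∀ y → R y ≡ true → ∃ λ u → y ≡ (u , φ)
Φ-elem P R R⊆ (u , φ) _ = u , refl
Φ-elem P R R⊆ (u , χ) e with R⊆ (u , χ) e
... | ()
Φ-elem P R R⊆ (u , ψ) e with R⊆ (u , ψ) e
... | ()

∣Φ∣ : ∀ {n} (P : Fin n → Bool) → ∣ Φ P ∣ ≡ countFin P
∣Φ∣ P rewrite countFin-false (λ v → Φ P (v , χ)) (λ _ → refl) = ℕ.+-identityʳ _

Φ-all : ∀ {n} → Subset n
Φ-all = Φ (λ _ → true)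

∣Φ-all∣ : ∀ {n} → ∣ Φ-all {n} ∣ ≡ n
∣Φ-all∣ {n} = trans (∣Φ∣ {n} (λ _ → true)) (countFin-true {n} (λ _ → true) (λ _ → refl))

other-vertex : ∀ {n} → 1 < n → (v : Fin n) → ∃ λ w → w ≢ v
other-vertex {suc (suc m)} _ zero = suc zero , λ ()
other-vertex {suc (suc m)} _ (suc v) = zero , λ ()
other-vertex {suc zero} (s≤s ()) zero

triples : ∀ {n} → (Fin n → Bool) → Subset n
triples P x = P (proj₁ x)

-- Since A + (A + I) = I, the three columns of each vertex sum to zero.
triple-sum : ∀ {n} (G : Graph n) (P : Fin n → Bool) → ∀ u → combination (column G) (triples P) u ≡ false
triple-sum G P u = xorFin-false _ (λ v → vanish (P v) (δ u v) (adj G u v))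
  where
  vanish : ∀ p d a → (p ∧ d) xor ((p ∧ a) xor (p ∧ (a xor d))) ≡ false
  vanish false d a = refl
  vanish true d a = trans (cong (d xor_) (≡-sym (xor-assoc a a d))) (trans (cong (λ z → d xor (z xor d)) (xor-same a)) (xor-same d))

triples-dependent : ∀ {n} (G : Graph n) (P : Fin n → Bool) → (∃ λ v → P v ≡ true) → Dependent G (triples P)
triples-dependent G P (v , pv) = triples P , (λ _ e → e) , ((v , φ) , pv) , triple-sum G P

module Columns {n : ℕ} (G : Graph n) where
  open Rank G public

  combination-Φ : (w : Vector n) → ∀ t → combination col (Φ w) t ≡ w t
  combination-Φ w t =
    trans (xorFin-single _ t (λ v v≢t → trans (cong (λ b → (w v ∧ b) xor false) (δ-≢ (λ e → v≢t (≡-sym e))))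
                                              (cong (_xor false) (∧-zeroʳ (w v)))))
          (trans (cong (λ b → (w t ∧ b) xor false) (δ-refl t)) (trans (xor-identityʳ _) (∧-identityʳ (w t))))

  span-supported : (Z : Subset n) (P : Fin n → Bool) → (∀ u → P u ≡ true → Span col Z (col (u , φ))) →
    (w : Vector n) → (∀ u → w u ≡ true → P u ≡ true) → Span col Z w
  span-supported Z P h w supp = span-trans col col (Φ w) Z φ-in-Z (Φ w , (λ _ e → e) , combination-Φ w)
    where
    φ-in-Z : ∀ y → Φ w y ≡ true → Span col Z (col y)
    φ-in-Z (u , φ) e = h u (supp u e)

  combination-at : (R : Subset n) (x : W n) (t : Fin n) → (∀ y → y ≢ x → R y ≡ true → col y t ≡ false) →
    combination col R t ≡ R x ∧ col x t
  combination-at R x t h = xorW-single (λ y → R y ∧ col y t) x vanish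
    where
    vanish : ∀ y → y ≢ x → R y ∧ col y t ≡ false
    vanish y y≢x with R y in e
    ... | true = h y y≢x e
    ... | false = refl

  unused-at : (R : Subset n) (x : W n) (t : Fin n) → (∀ u → combination col R u ≡ false) → col x t ≡ true →
    (∀ y → y ≢ x → R y ≡ true → col y t ≡ false) → R x ≡ false
  unused-at R x t eR cxt h =
    trans (≡-sym (∧-identityʳ (R x))) (trans (cong (R x ∧_) (≡-sym cxt)) (trans (≡-sym (combination-at R x t h)) (eR t)))

  Φ-independent : (P : Fin n → Bool) → LinIndependent col (Φ P)
  Φ-independent P (R , R⊆ , (y , ry) , eR) with Φ-elem P R R⊆ y ry
  ... | v , refl = true≢false (trans (≡-sym ry) (unused-at R (v , φ) v eR (δ-refl v) others))
    where
    others : ∀ y′ → y′ ≢ (v , φ) → R y′ ≡ true → col y′ v ≡ false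
    others y′ y′≢ ry′ with Φ-elem P R R⊆ y′ ry′
    ... | u , refl = δ-≢ (λ e → y′≢ (cong (_, φ) (≡-sym e)))

  basis⇒rank-n : (S B : Subset n) → B ⊆ S → LinIndependent col B → (∀ u → Span col B (col (u , φ))) →
    ∣ B ∣ ≡ n → IsRank G S n
  basis⇒rank-n S B B⊆S indB spans ∣B∣≡n = subst (IsRank G S) ∣B∣≡n
    (basis⇒IsRank S B B⊆S indB (λ x _ → span-supported B (λ _ → true) (λ u _ → spans u) (col x) (λ _ _ → refl)))

  Φ-all⊆⇒rank-n : (S : Subset n) → Φ-all ⊆ S → IsRank G S n
  Φ-all⊆⇒rank-n S Φ⊆S = basis⇒rank-n S Φ-all Φ⊆S (Φ-independent _) (λ u → span-∈ col Φ-all (u , φ) refl) ∣Φ-all∣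

  rank-full : IsRank G full n
  rank-full = Φ-all⊆⇒rank-n full (λ _ _ → refl)

  Φ-swap : Fin n → W n → Subset n
  Φ-swap w z = Φ (λ u → not (δ u w)) ∪ ｛ z ｝

  Φ-swap-member : ∀ w z {y} → Φ-swap w z y ≡ true → (∃ λ u → u ≢ w × y ≡ (u , φ)) ⊎ (y ≡ z)
  Φ-swap-member w z {u , φ} e with not (δ u w) in nd
  ... | true = inj₁ (u , δ-false (not-true nd) , refl)
  ... | false = inj₂ (≡-sym (｛｝-true e))
  Φ-swap-member w z {u , χ} e = inj₂ (≡-sym (｛｝-true e))
  Φ-swap-member w z {u , ψ} e = inj₂ (≡-sym (｛｝-true e))

  module _ (w : Fin n) (z : W n) (z∉Φ : proj₂ z ≢ φ) (czw : col z w ≡ true) where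

    private
      B = Φ-swap w z
      Φ′ = Φ (λ u → not (δ u w))

      Φ′-z : Φ′ z ≡ false
      Φ′-z = Φ-non-φ _ z z∉Φ

      in-Φ′ : ∀ y → B y ≡ true → z ≢ y → Φ′ y ≡ true
      in-Φ′ y e z≢y = ∨-true-false {Φ′ y} e (｛｝-other z≢y)

    Φ-swap-independent : LinIndependent col B
    Φ-swap-independent (R , R⊆ , (y , ry) , eR) = Φ-independent (λ _ → true) (R , R⊆Φ , (y , ry) , eR)
      where
      zero-at-w : ∀ y′ → y′ ≢ z → R y′ ≡ true → col y′ w ≡ false
      zero-at-w (u , φ) y′≢z ry′ =
        δ-≢ (λ w≡u → δ-false {v = u} {w = w} (not-true (in-Φ′ (u , φ) (R⊆ _ ry′) (λ e → y′≢z (≡-sym e)))) (≡-sym w≡u))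
      zero-at-w (u , χ) y′≢z ry′ = ⊥-elim (true≢false (≡-sym (in-Φ′ (u , χ) (R⊆ _ ry′) (λ e → y′≢z (≡-sym e)))))
      zero-at-w (u , ψ) y′≢z ry′ = ⊥-elim (true≢false (≡-sym (in-Φ′ (u , ψ) (R⊆ _ ry′) (λ e → y′≢z (≡-sym e)))))
      Rz : R z ≡ false
      Rz = unused-at R z w eR czw zero-at-w
      R⊆Φ : R ⊆ Φ-all
      R⊆Φ y′ e with Φ-elem _ R (λ y″ e″ → in-Φ′ y″ (R⊆ y″ e″) (λ { refl → true≢false (trans (≡-sym e″) Rz) })) y′ e
      ... | u , refl = refl

    -- e_w = col z + Σ e_t over the other rows t where col z has a 1.
    Φ-swap-spans : ∀ u → Span col B (col (u , φ))
    Φ-swap-spans u with u ≟ w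
    ... | no u≢w = span-∈ col B (u , φ) (∨-trueˡ (｛ z ｝ (u , φ)) (false⇒not-true (δ-≢ u≢w)))
    ... | yes refl = U , U⊆B , eq
      where
      rest : Vector n
      rest t = col z t ∧ not (δ t u)
      U : Subset n
      U y = ｛ z ｝ y xor Φ rest y
      U⊆B : U ⊆ B
      U⊆B y e with xor-true {｛ z ｝ y} e
      ... | inj₁ q = subst (λ x → B x ≡ true) (｛｝-true q) (∨-trueʳ (Φ′ z) (｛｝-self z))
      U⊆B (t , φ) e | inj₂ q = ∨-trueˡ (｛ z ｝ (t , φ)) (∧-trueʳ {col z t} q)
      unit : ∀ c d → (d ≡ true → c ≡ true) → c xor (c ∧ not d) ≡ d
      unit c true h rewrite h refl = refl
      unit false false h = refl
      unit true false h = refl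
      eq : ∀ t → combination col U t ≡ δ t u
      eq t = trans (combination-xor col ｛ z ｝ (Φ rest) t)
        (trans (cong₂ _xor_ (combination-｛｝ col z t) (combination-Φ rest t))
               (unit (col z t) (δ t u) (λ e → subst (λ x → col z x ≡ true) (≡-sym (δ-true e)) czw)))

    ∣Φ-swap∣ : ∣ B ∣ ≡ n
    ∣Φ-swap∣ = trans (∣∣-drop B Φ′ z (∨-trueʳ (Φ′ z) (｛｝-self z)) Φ′-z
                 (λ y y≢z → ≡-sym (trans (cong (Φ′ y ∨_) (｛｝-other (λ e → y≢z (≡-sym e)))) (∨-identityʳ _))))
               (trans (≡-sym (∣∣-drop Φ-all Φ′ (w , φ) refl (cong not (δ-refl w)) same-off-w)) ∣Φ-all∣)
      where
      same-off-w : ∀ y → y ≢ (w , φ) → Φ′ y ≡ Φ-all y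
      same-off-w (u , φ) y≢ = false⇒not-true (δ-≢ (λ e → y≢ (cong (_, φ) e)))
      same-off-w (u , χ) _ = refl
      same-off-w (u , ψ) _ = refl

    Φ-swap⊆⇒rank-n : (S : Subset n) → B ⊆ S → IsRank G S n
    Φ-swap⊆⇒rank-n S B⊆S = basis⇒rank-n S B B⊆S Φ-swap-independent Φ-swap-spans ∣Φ-swap∣

  crossing-edge : Connected G → (P : Fin n → Bool) → (∃ λ a → P a ≡ true) → (∃ λ b → P b ≡ false) →
    ∃ λ a → ∃ λ b → P a ≡ true × P b ≡ false × adj G a b ≡ true
  crossing-edge conn P inside outside
    with any? (λ a → any? (λ b → (P a 𝔹.≟ true) ×-dec (P b 𝔹.≟ false) ×-dec (adj G a b 𝔹.≟ true)))
  ... | yes e = proj₁ e , proj₂ e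
  ... | no ¬e = ⊥-elim (conn (P , inside , outside , λ a b pa pb → 𝔹.¬-not λ ab → ¬e (a , b , pa , pb , ab)))

  neighbour : Connected G → 1 < n → ∀ v → ∃ λ w → w ≢ v × adj G v w ≡ true
  neighbour conn n>1 v with other-vertex n>1 v
  ... | w , w≢v with crossing-edge conn (λ u → δ u v) (v , δ-refl v) (w , δ-≢ w≢v)
  ... | a , b , a≡v , b≢v , ab with δ-true {v = a} {w = v} a≡v
  ... | refl = b , δ-false b≢v , ab

  column-nonzero : Connected G → 1 < n → ∀ x → Nonzero (col x)
  column-nonzero conn n>1 (v , φ) = v , δ-refl v
  column-nonzero conn n>1 (v , χ) with neighbour conn n>1 v
  ... | w , w≢v , vw = w , trans (sym G w v) vw
  column-nonzero conn n>1 (v , ψ) with neighbour conn n>1 v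
  ... | w , w≢v , vw = w , cong₂ _xor_ (trans (sym G w v) vw) (δ-≢ w≢v)

  majority : Bool → Bool → Bool → Bool
  majority a b c = (a ∧ b) ∨ ((a ∧ c) ∨ (b ∧ c))

  heavy : Subset n → Fin n → Bool
  heavy S u = majority (S (u , φ)) (S (u , χ)) (S (u , ψ))

  heavy-∁ : (S : Subset n) (u : Fin n) → heavy (∁ S) u ≡ not (heavy S u)
  heavy-∁ S u = lemma (S (u , φ)) (S (u , χ)) (S (u , ψ))
    where
    lemma : ∀ a b c → majority (not a) (not b) (not c) ≡ not (majority a b c)
    lemma false false false = refl
    lemma false false true = refl
    lemma false true false = refl
    lemma false true true = refl
    lemma true false false = refl
    lemma true false true = refl
    lemma true true false = refl
    lemma true true true = refl

  -- Any two columns of a vertex span the third.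
  heavy-spans : (Z : Subset n) (u : Fin n) → heavy Z u ≡ true → ∀ k → Span col Z (col (u , k))
  heavy-spans Z u h = go (Z (u , φ)) (Z (u , χ)) (Z (u , ψ)) refl refl refl h
    where
    sum-of : ∀ k l → Z (u , k) ≡ true → Z (u , l) ≡ true → ∀ {w} → (∀ t → col (u , k) t xor col (u , l) t ≡ w t) →
      Span col Z w
    sum-of k l zk zl eq = span-cong col Z eq (span-xor col Z (span-∈ col Z (u , k) zk) (span-∈ col Z (u , l) zl))
    go : ∀ a b c → Z (u , φ) ≡ a → Z (u , χ) ≡ b → Z (u , ψ) ≡ c → majority a b c ≡ true →
      ∀ k → Span col Z (col (u , k))
    go true true c zφ zχ zψ _ φ = span-∈ col Z (u , φ) zφ
    go true true c zφ zχ zψ _ χ = span-∈ col Z (u , χ) zχ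
    go true true c zφ zχ zψ _ ψ = sum-of φ χ zφ zχ (λ t → xor-comm (δ t u) (adj G t u))
    go true false true zφ zχ zψ _ φ = span-∈ col Z (u , φ) zφ
    go true false true zφ zχ zψ _ ψ = span-∈ col Z (u , ψ) zψ
    go true false true zφ zχ zψ _ χ = sum-of φ ψ zφ zψ λ t →
      trans (cong (δ t u xor_) (xor-comm (adj G t u) (δ t u))) (trans (≡-sym (xor-assoc (δ t u) (δ t u) _))
            (cong (_xor adj G t u) (xor-same (δ t u))))
    go false true true zφ zχ zψ _ χ = span-∈ col Z (u , χ) zχ
    go false true true zφ zχ zψ _ ψ = span-∈ col Z (u , ψ) zψ
    go false true true zφ zχ zψ _ φ = sum-of χ ψ zχ zψ λ t →
      trans (≡-sym (xor-assoc (adj G t u) (adj G t u) _)) (cong (_xor δ t u) (xor-same (adj G t u)))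

  light-spans : (S : Subset n) (u : Fin n) → heavy S u ≡ false → ∀ k → Span col (∁ S) (col (u , k))
  light-spans S u l = heavy-spans (∁ S) u (trans (heavy-∁ S u) (cong not l))

  record SharedPair (S : Subset n) : Set where
    field
      p q : Vector n
      shared-p : Shared S p
      shared-q : Shared S q
      p≢q : ∃ λ u → p u ≢ q u

  -- For an edge xy from a heavy x to a light y: restrict A e_y to the heavy and A e_x to the light vertices.
  crossing⇒shared-pair : (S : Subset n) (x y : Fin n) → heavy S x ≡ true → heavy S y ≡ false → adj G x y ≡ true →
    SharedPair S
  crossing⇒shared-pair S x y hx ly xy = record
    { p = p ; q = q
    ; shared-p = (x , trans (cong₂ _∧_ hx refl) xy) , p∈S , p∈∁S
    ; shared-q = (y , trans (cong (λ b → not b ∧ adj G y x) ly) (trans (sym G y x) xy)) , q∈S , q∈∁S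
    ; p≢q = x , λ e → true≢false (trans (≡-sym (trans (cong₂ _∧_ hx refl) xy))
                                        (trans e (cong (λ b → not b ∧ adj G x x) hx)))
    }
    where
    p q : Vector n
    p t = heavy S t ∧ col (y , χ) t
    q t = not (heavy S t) ∧ col (x , χ) t
    on-heavy : (w : Vector n) → Span col S (λ t → heavy S t ∧ w t)
    on-heavy w = span-supported S (heavy S) (λ u h → heavy-spans S u h φ) _ (λ u e → ∧-trueˡ {heavy S u} e)
    on-light : (w : Vector n) → Span col (∁ S) (λ t → not (heavy S t) ∧ w t)
    on-light w = span-supported (∁ S) (λ u → not (heavy S u)) (λ u l → light-spans S u (not-true l) φ) _
                   (λ u e → ∧-trueˡ {not (heavy S u)} e)
    complement : ∀ a c → not a ∧ c ≡ c xor (a ∧ c)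
    complement false c = ≡-sym (xor-identityʳ c)
    complement true c = ≡-sym (xor-same c)
    p∈S = on-heavy (col (y , χ))
    q∈∁S = on-light (col (x , χ))
    p∈∁S : Span col (∁ S) p
    p∈∁S = span-cong col (∁ S) (λ t → trans (cong (col (y , χ) t xor_) (complement (heavy S t) _))
                                            (xor-cancelˡ (col (y , χ) t) _))
             (span-xor col (∁ S) (light-spans S y ly χ) (on-light (col (y , χ))))
    q∈S : Span col S q
    q∈S = span-cong col S (λ t → ≡-sym (complement (heavy S t) _))
             (span-xor col S (heavy-spans S x hx χ) (on-heavy (col (x , χ))))

  data HeavyLight (S : Subset n) : Set where
    crossing : SharedPair S → HeavyLight S
    all-heavy : (∀ u → heavy S u ≡ true) → HeavyLight S
    all-light : (∀ u → heavy S u ≡ false) → HeavyLight S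

  heavy-light : Connected G → (S : Subset n) → HeavyLight S
  heavy-light conn S with search (heavy S) | search (λ u → not (heavy S u))
  ... | inj₂ none | _ = all-light none
  ... | inj₁ _ | inj₂ none = all-heavy (λ u → not-false (none u))
  ... | inj₁ h | inj₁ (y , l) with crossing-edge conn (heavy S) h (y , not-true l)
  ... | a , b , ha , lb , ab = crossing (crossing⇒shared-pair S a b ha lb ab)

  shared-vector : Connected G → 1 < n → (S : Subset n) → (∃ λ x → S x ≡ true) → (∃ λ x → S x ≡ false) →
    Σ (Vector n) (Shared S)
  shared-vector conn n>1 S (s₁ , e₁) (s₂ , e₂) with heavy-light conn S
  ... | crossing r = SharedPair.p r , SharedPair.shared-p r
  ... | all-heavy h = col s₂ , column-nonzero conn n>1 s₂ , heavy-spans S (proj₁ s₂) (h _) (proj₂ s₂) ,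
                      span-∈ col (∁ S) s₂ (false⇒not-true e₂)
  ... | all-light l = col s₁ , column-nonzero conn n>1 s₁ , span-∈ col S s₁ e₁ , light-spans S (proj₁ s₁) (l _) (proj₂ s₁)

  TwoMembers : Subset n → Bool → Set
  TwoMembers S b = ∃ λ a → ∃ λ c → a ≢ c × S a ≡ b × S c ≡ b

  shared-pair : Connected G → 1 < n → (∀ x y → x ≢ y → ∃ λ u → col x u ≢ col y u) →
    (S : Subset n) → TwoMembers S true → TwoMembers S false → SharedPair S
  shared-pair conn n>1 distinct S (a₁ , a₂ , a₁≢a₂ , ea₁ , ea₂) (b₁ , b₂ , b₁≢b₂ , eb₁ , eb₂) with heavy-light conn S
  ... | crossing r = r
  ... | all-heavy h = record
    { p = col b₁ ; q = col b₂ ; p≢q = distinct b₁ b₂ b₁≢b₂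
    ; shared-p = column-nonzero conn n>1 b₁ , heavy-spans S (proj₁ b₁) (h _) (proj₂ b₁) , span-∈ col (∁ S) b₁ (false⇒not-true eb₁)
    ; shared-q = column-nonzero conn n>1 b₂ , heavy-spans S (proj₁ b₂) (h _) (proj₂ b₂) , span-∈ col (∁ S) b₂ (false⇒not-true eb₂) }
  ... | all-light l = record
    { p = col a₁ ; q = col a₂ ; p≢q = distinct a₁ a₂ a₁≢a₂
    ; shared-p = column-nonzero conn n>1 a₁ , span-∈ col S a₁ ea₁ , light-spans S (proj₁ a₁) (l _) (proj₂ a₁)
    ; shared-q = column-nonzero conn n>1 a₂ , span-∈ col S a₂ ea₂ , light-spans S (proj₁ a₂) (l _) (proj₂ a₂) }

-- Separations

¬ordinary<1 : ∀ {n} (G : Graph n) → ∀ j S → j < 1 → ¬ OrdinarySep G j S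
¬ordinary<1 G zero S _ ((_ , _ , ()) , _)
¬ordinary<1 G (suc j) S (s≤s ())

¬cyclic<1 : ∀ {n} (G : Graph n) → ∀ j S → j < 1 → ¬ CyclicSep G j S
¬cyclic<1 G zero S _ ((_ , _ , ()) , _)
¬cyclic<1 G (suc j) S (s≤s ())

∣∣≥1⇒member : ∀ {n} (S : Subset n) → 1 ≤ ∣ S ∣ → ∃ λ x → S x ≡ true
∣∣≥1⇒member S h = ∣∣-suc S (proj₂ (positive h))
  where
  positive : ∀ {m} → 1 ≤ m → ∃ λ k → m ≡ suc k
  positive {suc k} _ = k , refl

member⇒∣∣≥1 : ∀ {n} (S : Subset n) x → S x ≡ true → 1 ≤ ∣ S ∣
member⇒∣∣≥1 S x sx = subst (1 ≤_) (≡-sym (∣∣-─ S x sx)) (s≤s z≤n)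

∣∣≥2⇒two : ∀ {n} (S : Subset n) → 2 ≤ ∣ S ∣ → ∃ λ a → ∃ λ c → a ≢ c × S a ≡ true × S c ≡ true
∣∣≥2⇒two S h with ∣∣≥1⇒member S (ℕ.≤-trans (s≤s z≤n) h)
... | a , sa with ∣∣≥1⇒member (S ─ a) (ℕ.≤-pred (subst (2 ≤_) (∣∣-─ S a sa) h))
... | c , rc = a , c , ─-≢ {S = S} {a} rc , sa , ─-⊆ {S = S} {a} rc

two⇒∣∣≥2 : ∀ {n} (S : Subset n) a c → a ≢ c → S a ≡ true → S c ≡ true → 2 ≤ ∣ S ∣
two⇒∣∣≥2 S a c a≢c sa sc = subst (2 ≤_) (≡-sym (∣∣-─ S a sa)) (s≤s (member⇒∣∣≥1 (S ─ a) c (─-intro {S = S} sc a≢c)))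

three⇒∣∣≥3 : ∀ {n} (S : Subset n) a b c → a ≢ b → a ≢ c → b ≢ c → S a ≡ true → S b ≡ true → S c ≡ true →
  3 ≤ ∣ S ∣
three⇒∣∣≥3 S a b c a≢b a≢c b≢c sa sb sc = subst (3 ≤_) (≡-sym (∣∣-─ S a sa))
  (s≤s (two⇒∣∣≥2 (S ─ a) b c b≢c (─-intro {S = S} sb a≢b) (─-intro {S = S} sc a≢c)))

dependent⇒member : ∀ {n} (G : Graph n) (S : Subset n) → Dependent G S → ∃ λ x → S x ≡ true
dependent⇒member G S (U , U⊆S , (x , ux) , _) = x , U⊆S x ux

-- With r(M) = n the bound κ* ≤ |W| - r(M) = 2n is not binding for k ≤ 2n.
τ≡κ*≡ : ∀ {n} (G : Graph n) (k : ℕ) (S : Subset n) → OrdinarySep G k S → CyclicSep G k S → IsRank G full n →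
  k ≤ n + n → (∀ j T → j < k → ¬ OrdinarySep G j T) → (∀ j T → j < k → ¬ CyclicSep G j T) →
  IsTau G (just k) × IsKappa G k
τ≡κ*≡ {n} G k S ord cyc rank k≤2n no-ord no-cyc =
  ((S , ord) , λ j T → least (no-ord j T)) ,
  (n , rank , inj₂ (S , cyc) , subst (k ≤_) (≡-sym 3n∸n≡2n) k≤2n , λ j T → least (no-cyc j T))
  where
  least : ∀ {j} {P : Set} → (j < k → ¬ P) → P → k ≤ j
  least {j} h p with k ℕ.≤? j
  ... | yes k≤j = k≤j
  ... | no k≰j = ⊥-elim (h (ℕ.≰⇒> k≰j) p)
  3n∸n≡2n : 3 * n ∸ n ≡ n + n
  3n∸n≡2n = trans (ℕ.m+n∸m≡n n (n + (n + 0))) (cong (n +_) (ℕ.+-identityʳ n))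

combination-pair : ∀ {n m} (f : W n → Vector m) (x y : W n) → ∀ u → combination f (pair x y) u ≡ f x u xor f y u
combination-pair f x y u = trans (combination-xor f ｛ x ｝ ｛ y ｝ u) (cong₂ _xor_ (combination-｛｝ f x u) (combination-｛｝ f y u))

other-kind : Kind → Kind
other-kind φ = χ
other-kind χ = ψ
other-kind ψ = χ

other-kind-≢ : ∀ k → other-kind k ≢ k
other-kind-≢ φ ()
other-kind-≢ χ ()
other-kind-≢ ψ ()

other-kind-≢φ : ∀ k → other-kind k ≢ φ
other-kind-≢φ φ ()
other-kind-≢φ χ ()
other-kind-≢φ ψ ()

-- Two parallel elements x = (v, kx), y = (w, ky) on distinct vertices, with x ∉ Φ, form a 2-separation.
module ParallelPair {n : ℕ} (G : Graph n) (v w : Fin n) (kx ky : Kind) (v≢w : v ≢ w) (kx≢φ : kx ≢ φ)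
  (parallel : ∀ u → column G (v , kx) u ≡ column G (w , ky) u) (x-nonzero : Nonzero (column G (v , kx)))
  (rank-avoiding : (T : Subset n) → (∀ z → z ≢ (v , kx) → z ≢ (w , ky) → T z ≡ true) → IsRank G T n) where
  open Columns G

  x y : W n
  x = v , kx
  y = w , ky

  x≢y : x ≢ y
  x≢y e = v≢w (cong proj₁ e)

  S : Subset n
  S = pair x y

  outside : ∀ z → z ≢ x → z ≢ y → ∁ S z ≡ true
  outside z z≢x z≢y = false⇒not-true (pair-outside z≢x z≢y)

  rank-S : IsRank G S 1
  rank-S = subst (IsRank G S) (∣｛｝∣ x) (basis⇒IsRank S ｛ x ｝ x∈S ｛x｝-independent spans)
    where
    x∈S : ｛ x ｝ ⊆ S
    x∈S z e = subst (λ t → S t ≡ true) (｛｝-true e) (pair-left x≢y)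
    ｛x｝-independent : LinIndependent col ｛ x ｝
    ｛x｝-independent (R , R⊆ , (z , rz) , eR) with ｛｝-true {x = x} {y = z} (R⊆ z rz)
    ... | refl = true≢false (trans (≡-sym rz) (unused-at R x (proj₁ x-nonzero) eR (proj₂ x-nonzero)
                   (λ y′ y′≢x ry′ → ⊥-elim (y′≢x (≡-sym (｛｝-true {x = x} {y = y′} (R⊆ y′ ry′)))))))
    spans : ∀ z → S z ≡ true → Span col ｛ x ｝ (col z)
    spans z e with pair-member x y e
    ... | inj₁ refl = span-∈ col ｛ x ｝ x (｛｝-self x)
    ... | inj₂ refl = span-cong col ｛ x ｝ parallel (span-∈ col ｛ x ｝ x (｛｝-self x))

  λ<2 : LambdaLt G S 2
  λ<2 = 1 , (1 , n , n , rank-S , rank-avoiding (∁ S) outside , rank-full , refl) , s≤s (s≤s z≤n)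

  S-dependent : Dependent G S
  S-dependent = S , (λ _ e → e) , (x , pair-left x≢y) , λ u →
    trans (combination-pair col x y u) (trans (cong (col x u xor_) (≡-sym (parallel u))) (xor-same (col x u)))

  -- The six columns at v and w sum to zero, so removing x and y leaves a dependent set.
  ∁S-dependent : Dependent G (∁ S)
  ∁S-dependent = U , U⊆∁S , ((v , φ) , Uvφ) , λ u →
    trans (combination-xor col (triples vw) S u)
          (cong₂ _xor_ (triple-sum G vw u) (proj₂ (proj₂ (proj₂ S-dependent)) u))
    where
    vw : Fin n → Bool
    vw u = δ u v xor δ u w
    vw-v : vw v ≡ true
    vw-v = cong₂ _xor_ (δ-refl v) (δ-≢ v≢w)
    vw-w : vw w ≡ true
    vw-w = cong₂ _xor_ (δ-≢ (λ e → v≢w (≡-sym e))) (δ-refl w)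
    U : Subset n
    U z = vw (proj₁ z) xor S z
    Uvφ : U (v , φ) ≡ true
    Uvφ = cong₂ _xor_ vw-v (pair-outside {x = x} {y = y} (λ e → kx≢φ (≡-sym (cong proj₂ e))) (λ e → v≢w (cong proj₁ e)))
    U⊆∁S : U ⊆ ∁ S
    U⊆∁S z e with S z in sz
    ... | false = refl
    ... | true with pair-member x y sz
    ... | inj₁ refl = ⊥-elim (true≢false (trans (≡-sym e) (cong (_xor true) vw-v)))
    ... | inj₂ refl = ⊥-elim (true≢false (trans (≡-sym e) (cong (_xor true) vw-w)))

  ordinary : OrdinarySep G 2 S
  ordinary = λ<2 , two⇒∣∣≥2 S x y x≢y (pair-left x≢y) (pair-right x≢y) ,
    two⇒∣∣≥2 (∁ S) (v , φ) (v , other-kind kx) (λ e → other-kind-≢φ kx (≡-sym (cong proj₂ e)))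
      (outside (v , φ) (λ e → kx≢φ (≡-sym (cong proj₂ e))) (λ e → v≢w (cong proj₁ e)))
      (outside (v , other-kind kx) (λ e → other-kind-≢ kx (cong proj₂ e)) (λ e → v≢w (cong proj₁ e)))

  cyclic : CyclicSep G 2 S
  cyclic = λ<2 , S-dependent , ∁S-dependent

combination-⊆pair : ∀ {n m} (f : W n → Vector m) {x y : W n} (R : Subset n) → R ⊆ pair x y → x ≢ y →
  ∀ u → combination f R u ≡ (R x ∧ f x u) xor (R y ∧ f y u)
combination-⊆pair f {x} {y} R R⊆ x≢y u =
  trans (combination-cong f on-pair u)
  (trans (combination-xor f (λ z → R x ∧ ｛ x ｝ z) (λ z → R y ∧ ｛ y ｝ z) u)
         (cong₂ _xor_ (trans (combination-∧ f (R x) ｛ x ｝ u) (cong (R x ∧_) (combination-｛｝ f x u)))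
                      (trans (combination-∧ f (R y) ｛ y ｝ u) (cong (R y ∧_) (combination-｛｝ f y u)))))
  where
  on-pair : ∀ z → R z ≡ (R x ∧ ｛ x ｝ z) xor (R y ∧ ｛ y ｝ z)
  on-pair z with x ≟W z | y ≟W z
  ... | yes refl | yes refl = ⊥-elim (x≢y refl)
  ... | yes refl | no _ = ≡-sym (trans (cong (R x ∧ true xor_) (∧-zeroʳ (R y))) (trans (xor-identityʳ _) (∧-identityʳ _)))
  ... | no _ | yes refl = ≡-sym (trans (cong (_xor (R y ∧ true)) (∧-zeroʳ (R x))) (∧-identityʳ _))
  ... | no x≢z | no y≢z with R z in rz
  ... | false = ≡-sym (cong₂ _xor_ (∧-zeroʳ (R x)) (∧-zeroʳ (R y)))
  ... | true with pair-member x y (R⊆ z rz)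
  ... | inj₁ refl = ⊥-elim (x≢z refl)
  ... | inj₂ refl = ⊥-elim (y≢z refl)

pair-independent : ∀ {n m} (f : W n → Vector m) {x y : W n} → x ≢ y → Nonzero (f x) → Nonzero (f y) →
  (∃ λ u → f x u ≢ f y u) → LinIndependent f (pair x y)
pair-independent f {x} {y} x≢y (u₁ , fx) (u₂ , fy) (u₃ , fx≢fy) (R , R⊆ , (z , rz) , eR) = by-cases (R x) (R y) refl refl
  where
  sum : ∀ a b → R x ≡ a → R y ≡ b → ∀ u → (a ∧ f x u) xor (b ∧ f y u) ≡ false
  sum a b refl refl u = trans (≡-sym (combination-⊆pair f R R⊆ x≢y u)) (eR u)
  by-cases : ∀ a b → R x ≡ a → R y ≡ b → ⊥
  by-cases true true rx ry = fx≢fy (≡-sym (xor-false (f x u₃) (f y u₃) (sum true true rx ry u₃)))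
  by-cases true false rx ry = true≢false (trans (≡-sym fx) (trans (≡-sym (xor-identityʳ _)) (sum true false rx ry u₁)))
  by-cases false true rx ry = true≢false (trans (≡-sym fy) (sum false true rx ry u₂))
  by-cases false false rx ry with pair-member x y (R⊆ z rz)
  ... | inj₁ refl = true≢false (trans (≡-sym rz) rx)
  ... | inj₂ refl = true≢false (trans (≡-sym rz) ry)

module ConnectedGraph {n : ℕ} (G : Graph n) (conn : Connected G) (n>1 : 1 < n) where
  open Columns G

  ∁-member : (S : Subset n) → (∃ λ x → ∁ S x ≡ true) → ∃ λ x → S x ≡ false
  ∁-member S (x , e) = x , not-true e

  ¬ordinary₁ : ∀ S → ¬ OrdinarySep G 1 S
  ¬ordinary₁ S (λ<1 , ∣S∣≥1 , ∣∁S∣≥1) with shared-vector conn n>1 S (∣∣≥1⇒member S ∣S∣≥1)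
                                          (∁-member S (∣∣≥1⇒member (∁ S) ∣∁S∣≥1))
  ... | _ , shared = shared⇒¬λ<1 S shared λ<1

  ¬cyclic₁ : ∀ S → ¬ CyclicSep G 1 S
  ¬cyclic₁ S (λ<1 , dS , d∁S) with shared-vector conn n>1 S (dependent⇒member G S dS)
                                    (∁-member S (dependent⇒member G (∁ S) d∁S))
  ... | _ , shared = shared⇒¬λ<1 S shared λ<1

  ¬ordinary<2 : ∀ j S → j < 2 → ¬ OrdinarySep G j S
  ¬ordinary<2 zero S _ ((_ , _ , ()) , _)
  ¬ordinary<2 (suc zero) S _ = ¬ordinary₁ S
  ¬ordinary<2 (suc (suc j)) S (s≤s (s≤s ()))

  ¬cyclic<2 : ∀ j S → j < 2 → ¬ CyclicSep G j S
  ¬cyclic<2 zero S _ ((_ , _ , ()) , _)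
  ¬cyclic<2 (suc zero) S _ = ¬cyclic₁ S
  ¬cyclic<2 (suc (suc j)) S (s≤s (s≤s ()))

  2≤2n : 2 ≤ n + n
  2≤2n = ℕ.≤-trans n>1 (ℕ.m≤m+n n n)

  from-parallel-pair : ∀ v w kx ky (v≢w : v ≢ w) (kx≢φ : kx ≢ φ) (parallel : ∀ u → col (v , kx) u ≡ col (w , ky) u) →
    ((T : Subset n) → (∀ z → z ≢ (v , kx) → z ≢ (w , ky) → T z ≡ true) → IsRank G T n) →
    IsTau G (just 2) × IsKappa G 2
  from-parallel-pair v w kx ky v≢w kx≢φ parallel rank-avoiding =
    τ≡κ*≡ G 2 P.S P.ordinary P.cyclic rank-full 2≤2n ¬ordinary<2 ¬cyclic<2
    where module P = ParallelPair G v w kx ky v≢w kx≢φ parallel (column-nonzero conn n>1 (v , kx)) rank-avoiding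

  col-off-diagonal : ∀ v k → k ≢ φ → ∀ u → u ≢ v → col (v , k) u ≡ adj G v u
  col-off-diagonal v φ k≢φ u _ = ⊥-elim (k≢φ refl)
  col-off-diagonal v χ _ u _ = sym G u v
  col-off-diagonal v ψ _ u u≢v = trans (cong (adj G u v xor_) (δ-≢ u≢v)) (trans (xor-identityʳ _) (sym G u v))

  -- If v is pendant on w, then χ(v) or ψ(v) (whichever removes the loop at v) is parallel to φ(w).
  pendant⇒τ≡κ*≡2 : ∀ v w → PendantOn G v w → IsTau G (just 2) × IsKappa G 2
  pendant⇒τ≡κ*≡2 v w pendant =
    from-parallel-pair v w (proj₁ kx) φ v≢w (proj₁ (proj₂ kx)) (proj₂ (proj₂ kx)) rank-avoiding
    where
    vw : Nbr G v w
    vw = proj₂ (pendant w) refl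
    v≢w : v ≢ w
    v≢w e = proj₁ vw (≡-sym e)
    adj-v : ∀ u → u ≢ v → adj G v u ≡ δ u w
    adj-v u u≢v with u ≟ w
    ... | yes refl = proj₂ vw
    ... | no u≢w with adj G v u in e
    ... | true = ⊥-elim (u≢w (proj₁ (pendant u) (u≢v , e)))
    ... | false = refl
    kx : Σ Kind λ k → k ≢ φ × (∀ u → col (v , k) u ≡ col (w , φ) u)
    kx with adj G v v in loop
    ... | false = χ , (λ ()) , parallel
      where
      parallel : ∀ u → col (v , χ) u ≡ δ u w
      parallel u with u ≟ v
      ... | yes refl = trans loop (≡-sym (δ-≢ v≢w))
      ... | no u≢v = trans (sym G u v) (adj-v u u≢v)
    ... | true = ψ , (λ ()) , parallel
      where
      parallel : ∀ u → col (v , ψ) u ≡ δ u w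
      parallel u with u ≟ v
      ... | yes refl = trans (cong (_xor true) loop) (≡-sym (δ-≢ v≢w))
      ... | no u≢v = trans (xor-identityʳ _) (trans (sym G u v) (adj-v u u≢v))
    -- a non-φ element at w with a 1 in row w, to replace φ(w) in Φ-all
    kz : Σ Kind λ k → k ≢ φ × col (w , k) w ≡ true
    kz with adj G w w in loop
    ... | true = χ , (λ ()) , loop
    ... | false = ψ , (λ ()) , cong₂ _xor_ loop (δ-refl w)
    rank-avoiding : (T : Subset n) → (∀ z → z ≢ (v , proj₁ kx) → z ≢ (w , φ) → T z ≡ true) → IsRank G T n
    rank-avoiding T avoid = Φ-swap⊆⇒rank-n w (w , proj₁ kz) (proj₁ (proj₂ kz)) (proj₂ (proj₂ kz)) T avoids
      where
      avoids : Φ-swap w (w , proj₁ kz) ⊆ T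
      avoids y e with Φ-swap-member w (w , proj₁ kz) e
      ... | inj₁ (u , u≢w , refl) = avoid _ (λ eq → proj₁ (proj₂ kx) (≡-sym (cong proj₂ eq))) (λ eq → u≢w (cong proj₁ eq))
      ... | inj₂ refl = avoid _ (λ eq → v≢w (≡-sym (cong proj₁ eq))) (λ eq → proj₁ (proj₂ kz) (cong proj₂ eq))

  diagonal : ∀ v e → Σ Kind λ k → k ≢ φ × col (v , k) v ≡ e
  diagonal v false with adj G v v in loop
  ... | false = χ , (λ ()) , loop
  ... | true = ψ , (λ ()) , cong₂ _xor_ loop (δ-refl v)
  diagonal v true with adj G v v in loop
  ... | true = χ , (λ ()) , loop
  ... | false = ψ , (λ ()) , cong₂ _xor_ loop (δ-refl v)

  twins⇒τ≡κ*≡2 : ∀ v w → Twins G v w → IsTau G (just 2) × IsKappa G 2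
  twins⇒τ≡κ*≡2 v w (v≢w , twins) = from-parallel-pair v w kv kw v≢w kv≢φ parallel rank-avoiding
    where
    ε = adj G v w
    kv = proj₁ (diagonal v ε)
    kw = proj₁ (diagonal w ε)
    kv≢φ = proj₁ (proj₂ (diagonal v ε))
    kw≢φ = proj₁ (proj₂ (diagonal w ε))
    agree : ∀ u → u ≢ v → u ≢ w → adj G v u ≡ adj G w u
    agree u u≢v u≢w with adj G v u in vu | adj G w u in wu
    ... | true | true = refl
    ... | false | false = refl
    ... | true | false = ⊥-elim (true≢false (trans (≡-sym (proj₂ (proj₁ (proj₁ (twins u) ((u≢v , vu) , u≢w))))) wu))
    ... | false | true = ⊥-elim (true≢false (trans (≡-sym (proj₂ (proj₁ (proj₂ (twins u) ((u≢w , wu) , u≢v))))) vu))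
    parallel : ∀ u → col (v , kv) u ≡ col (w , kw) u
    parallel u with u ≟ v | u ≟ w
    ... | yes refl | _ = trans (proj₂ (proj₂ (diagonal v ε)))
                               (≡-sym (trans (col-off-diagonal w kw kw≢φ v v≢w) (sym G w v)))
    ... | no u≢v | yes refl = trans (col-off-diagonal v kv kv≢φ w u≢v) (≡-sym (proj₂ (proj₂ (diagonal w ε))))
    ... | no u≢v | no u≢w =
      trans (col-off-diagonal v kv kv≢φ u u≢v) (trans (agree u u≢v u≢w) (≡-sym (col-off-diagonal w kw kw≢φ u u≢w)))
    rank-avoiding : (T : Subset n) → (∀ z → z ≢ (v , kv) → z ≢ (w , kw) → T z ≡ true) → IsRank G T n
    rank-avoiding T avoid = Φ-all⊆⇒rank-n T λ { (u , φ) _ → avoid (u , φ) (λ eq → kv≢φ (≡-sym (cong proj₂ eq)))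
                                                                       (λ eq → kw≢φ (≡-sym (cong proj₂ eq))) }

  pendant-or-twins⇒τ≡κ*≡2 : HasPendant G ⊎ HasTwins G → IsTau G (just 2) × IsKappa G 2
  pendant-or-twins⇒τ≡κ*≡2 (inj₁ (v , w , pendant)) = pendant⇒τ≡κ*≡2 v w pendant
  pendant-or-twins⇒τ≡κ*≡2 (inj₂ (v , w , twins)) = twins⇒τ≡κ*≡2 v w twins

  module NoPendantNoTwins (no-pendant : ¬ HasPendant G) (no-twins : ¬ HasTwins G) where

    -- A non-φ column at w equal to e_v makes w pendant on v (or, for w = v, hides the neighbours of v).
    φ-not-parallel : ∀ v w k → k ≢ φ → ¬ (∀ u → col (v , φ) u ≡ col (w , k) u)
    φ-not-parallel v w k k≢φ parallel with v ≟ w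
    ... | yes refl with neighbour conn n>1 v
    ... | t , t≢v , vt =
      true≢false (trans (≡-sym (trans (parallel t) (trans (col-off-diagonal v k k≢φ t t≢v) vt))) (δ-≢ t≢v))
    φ-not-parallel v w k k≢φ parallel | no v≢w = no-pendant (w , v , λ u → only-v u , is-nbr u)
      where
      only-v : ∀ u → Nbr G w u → u ≡ v
      only-v u (u≢w , wu) = δ-true (trans (parallel u) (trans (col-off-diagonal w k k≢φ u u≢w) wu))
      is-nbr : ∀ u → u ≡ v → Nbr G w u
      is-nbr u refl = (λ e → v≢w e) , trans (≡-sym (col-off-diagonal w k k≢φ v v≢w)) (trans (≡-sym (parallel v)) (δ-refl v))

    -- Parallel non-φ elements at distinct vertices would be twins; at one vertex, χ and ψ differ on the diagonal.
    non-φ-parallel : ∀ v w k l → k ≢ φ → l ≢ φ → (∀ u → col (v , k) u ≡ col (w , l) u) → (v , k) ≡ (w , l)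
    non-φ-parallel v w k l k≢φ l≢φ parallel with v ≟ w
    ... | no v≢w = ⊥-elim (no-twins (v , w , v≢w , λ u → to u , from u))
      where
      agree : ∀ u → u ≢ v → u ≢ w → adj G v u ≡ adj G w u
      agree u u≢v u≢w = trans (≡-sym (col-off-diagonal v k k≢φ u u≢v)) (trans (parallel u) (col-off-diagonal w l l≢φ u u≢w))
      to : ∀ u → Nbr G v u × u ≢ w → Nbr G w u × u ≢ v
      to u ((u≢v , vu) , u≢w) = (u≢w , trans (≡-sym (agree u u≢v u≢w)) vu) , u≢v
      from : ∀ u → Nbr G w u × u ≢ v → Nbr G v u × u ≢ w
      from u ((u≢w , wu) , u≢v) = (u≢v , trans (agree u u≢v u≢w) wu) , u≢w
    non-φ-parallel v .v φ l k≢φ l≢φ parallel | yes refl = ⊥-elim (k≢φ refl)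
    non-φ-parallel v .v k φ k≢φ l≢φ parallel | yes refl = ⊥-elim (l≢φ refl)
    non-φ-parallel v .v χ χ k≢φ l≢φ parallel | yes refl = refl
    non-φ-parallel v .v ψ ψ k≢φ l≢φ parallel | yes refl = refl
    non-φ-parallel v .v χ ψ k≢φ l≢φ parallel | yes refl =
      ⊥-elim (b≢b-xor-true (adj G v v) (trans (parallel v) (cong (adj G v v xor_) (δ-refl v))))
    non-φ-parallel v .v ψ χ k≢φ l≢φ parallel | yes refl =
      ⊥-elim (b≢b-xor-true (adj G v v) (trans (≡-sym (parallel v)) (cong (adj G v v xor_) (δ-refl v))))

    columns-injective : ∀ x y → (∀ u → col x u ≡ col y u) → x ≡ y
    columns-injective (v , φ) (w , φ) parallel = cong (_, φ) (δ-true (trans (≡-sym (parallel v)) (δ-refl v)))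
    columns-injective (v , φ) (w , χ) parallel = ⊥-elim (φ-not-parallel v w χ (λ ()) parallel)
    columns-injective (v , φ) (w , ψ) parallel = ⊥-elim (φ-not-parallel v w ψ (λ ()) parallel)
    columns-injective (v , χ) (w , φ) parallel = ⊥-elim (φ-not-parallel w v χ (λ ()) (λ u → ≡-sym (parallel u)))
    columns-injective (v , ψ) (w , φ) parallel = ⊥-elim (φ-not-parallel w v ψ (λ ()) (λ u → ≡-sym (parallel u)))
    columns-injective (v , χ) (w , χ) parallel = non-φ-parallel v w χ χ (λ ()) (λ ()) parallel
    columns-injective (v , χ) (w , ψ) parallel = non-φ-parallel v w χ ψ (λ ()) (λ ()) parallel
    columns-injective (v , ψ) (w , χ) parallel = non-φ-parallel v w ψ χ (λ ()) (λ ()) parallel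
    columns-injective (v , ψ) (w , ψ) parallel = non-φ-parallel v w ψ ψ (λ ()) (λ ()) parallel

    distinct-columns : ∀ x y → x ≢ y → ∃ λ u → col x u ≢ col y u
    distinct-columns x y x≢y with search (λ u → col x u xor col y u)
    ... | inj₁ (u , differ) = u , λ same → true≢false (trans (≡-sym differ)
                                             (trans (cong (col x u xor_) (≡-sym same)) (xor-same (col x u))))
    ... | inj₂ agree = ⊥-elim (x≢y (columns-injective x y (λ u → ≡-sym (xor-false (col x u) (col y u) (agree u)))))

    dependent⇒two : (S : Subset n) → Dependent G S → TwoMembers S true
    dependent⇒two S (U , U⊆S , (x , ux) , eU) with searchW (U ─ x)
    ... | inj₁ (y , e) = x , y , ─-≢ {S = U} {x} e , U⊆S x ux , U⊆S y (─-⊆ {S = U} {x} e)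
    ... | inj₂ U⊆｛x｝ with column-nonzero conn n>1 x
    ... | u , cxu = ⊥-elim (true≢false (trans (≡-sym cxu) (trans (≡-sym (xor-identityʳ _))
          (trans (cong₂ (λ a b → (a ∧ col x u) xor b) (≡-sym ux) (≡-sym (combination-∅ col (U ─ x) U⊆｛x｝ u)))
                 (trans (≡-sym (combination-split col U x u)) (eU u))))))

    ∁-two : (S : Subset n) → TwoMembers (∁ S) true → TwoMembers S false
    ∁-two S (a , c , a≢c , ea , ec) = a , c , a≢c , not-true ea , not-true ec

    ¬λ<2 : (S : Subset n) → TwoMembers S true → TwoMembers S false → ¬ LambdaLt G S 2
    ¬λ<2 S inside outside = shared₂⇒¬λ<2 S (SharedPair.shared-p r) (SharedPair.shared-q r) (SharedPair.p≢q r)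
      where r = shared-pair conn n>1 distinct-columns S inside outside

    ¬ordinary<3 : ∀ j S → j < 3 → ¬ OrdinarySep G j S
    ¬ordinary<3 (suc (suc zero)) S _ (λ<2 , ∣S∣≥2 , ∣∁S∣≥2) = ¬λ<2 S (∣∣≥2⇒two S ∣S∣≥2) (∁-two S (∣∣≥2⇒two (∁ S) ∣∁S∣≥2)) λ<2
    ¬ordinary<3 (suc (suc (suc j))) S (s≤s (s≤s (s≤s ())))
    ¬ordinary<3 zero S _ = ¬ordinary<2 zero S (s≤s z≤n)
    ¬ordinary<3 (suc zero) S _ = ¬ordinary<2 1 S (s≤s (s≤s z≤n))

    ¬cyclic<3 : ∀ j S → j < 3 → ¬ CyclicSep G j S
    ¬cyclic<3 (suc (suc zero)) S _ (λ<2 , dS , d∁S) = ¬λ<2 S (dependent⇒two S dS) (∁-two S (dependent⇒two (∁ S) d∁S)) λ<2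
    ¬cyclic<3 (suc (suc (suc j))) S (s≤s (s≤s (s≤s ())))
    ¬cyclic<3 zero S _ = ¬cyclic<2 zero S (s≤s z≤n)
    ¬cyclic<3 (suc zero) S _ = ¬cyclic<2 1 S (s≤s (s≤s z≤n))

    τ≡κ*≡3 : IsTau G (just 3) × IsKappa G 3
    τ≡κ*≡3 = τ≡κ*≡ G 3 S ordinary cyclic rank-full 3≤2n ¬ordinary<3 ¬cyclic<3
      where
      3≤2n : 3 ≤ n + n
      3≤2n = ℕ.≤-trans (s≤s (s≤s (s≤s z≤n))) (ℕ.+-mono-≤ n>1 n>1)
      v : Fin n
      v = first n>1
        where
        first : ∀ {m} → 1 < m → Fin m
        first {suc m} _ = zero
      u′ = proj₁ (other-vertex n>1 v)
      u′≢v = proj₂ (other-vertex n>1 v)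
      t = proj₁ (neighbour conn n>1 v)
      t≢v = proj₁ (proj₂ (neighbour conn n>1 v))
      vt = proj₂ (proj₂ (neighbour conn n>1 v))
      -- S is the triple of v: rank 2 from {φ(v), χ(v)}, while its complement has full rank n.
      S : Subset n
      S = triples (λ u → δ u v)
      vφ vχ : W n
      vφ = v , φ
      vχ = v , χ
      rank-S : IsRank G S 2
      rank-S = subst (IsRank G S) ∣B∣≡2 (basis⇒IsRank S B B⊆S B-independent spans)
        where
        B = pair vφ vχ
        vφ≢vχ : vφ ≢ vχ
        vφ≢vχ ()
        ∣B∣≡2 : ∣ B ∣ ≡ 2
        ∣B∣≡2 = trans (∣∣-─ B vφ (pair-left vφ≢vχ)) (cong suc (trans (∣∣-─ (B ─ vφ) vχ (─-intro {S = B} (pair-right vφ≢vχ) vφ≢vχ))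
                  (cong suc (∣∣-false _ λ z → nothing-else z))))
          where
          nothing-else : ∀ z → ((B ─ vφ) ─ vχ) z ≡ false
          nothing-else z with ((B ─ vφ) ─ vχ) z in e
          ... | false = refl
          ... | true with pair-member vφ vχ (─-⊆ {S = B} {vφ} (─-⊆ {S = B ─ vφ} {vχ} e))
          ... | inj₁ refl = ⊥-elim (─-≢ {S = B} {vφ} (─-⊆ {S = B ─ vφ} {vχ} e) refl)
          ... | inj₂ refl = ⊥-elim (─-≢ {S = B ─ vφ} {vχ} e refl)
        B⊆S : B ⊆ S
        B⊆S z e with pair-member vφ vχ e
        ... | inj₁ refl = δ-refl v
        ... | inj₂ refl = δ-refl v
        B-independent : LinIndependent col B
        B-independent = pair-independent col vφ≢vχ (column-nonzero conn n>1 vφ) (column-nonzero conn n>1 vχ)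
          (t , λ e → true≢false (trans (≡-sym (trans (sym G t v) vt)) (trans (≡-sym e) (δ-≢ t≢v))))
        v-heavy : heavy B v ≡ true
        v-heavy = cong₂ (λ a b → majority a b (B (v , ψ))) (pair-left vφ≢vχ) (pair-right vφ≢vχ)
        spans : ∀ z → S z ≡ true → Span col B (col z)
        spans (u , k) e with δ-true {v = u} {w = v} e
        ... | refl = heavy-spans B v v-heavy k
      rank-∁S : IsRank G (∁ S) n
      rank-∁S = Φ-swap⊆⇒rank-n v (t , χ) (λ ()) vt (∁ S) in-∁S
        where
        in-∁S : Φ-swap v (t , χ) ⊆ ∁ S
        in-∁S y e with Φ-swap-member v (t , χ) e
        ... | inj₁ (u , u≢v , refl) = false⇒not-true (δ-≢ u≢v)
        ... | inj₂ refl = false⇒not-true (δ-≢ t≢v)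
      λ<3 : LambdaLt G S 3
      λ<3 = 2 , (2 , n , n , rank-S , rank-∁S , rank-full , refl) , s≤s (s≤s (s≤s z≤n))
      u′-outside : ∀ k → ∁ S (u′ , k) ≡ true
      u′-outside k = false⇒not-true (δ-≢ u′≢v)
      ordinary : OrdinarySep G 3 S
      ordinary = λ<3 , three⇒∣∣≥3 S vφ vχ (v , ψ) (λ ()) (λ ()) (λ ()) (δ-refl v) (δ-refl v) (δ-refl v) ,
        three⇒∣∣≥3 (∁ S) (u′ , φ) (u′ , χ) (u′ , ψ) (λ ()) (λ ()) (λ ()) (u′-outside φ) (u′-outside χ) (u′-outside ψ)
      cyclic : CyclicSep G 3 S
      cyclic = λ<3 , triples-dependent G (λ u → δ u v) (v , δ-refl v) ,
        triples-dependent G (λ u → not (δ u v)) (u′ , u′-outside φ)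

-- One vertex, or several components

countFin-complement : ∀ {m} (P : Fin m → Bool) → countFin P + countFin (λ u → not (P u)) ≡ m
countFin-complement {m} P =
  trans (≡-sym (countFin-∨+∧ P (λ u → not (P u))))
        (trans (cong₂ _+_ (countFin-true _ (λ u → 𝔹.∨-inverseʳ (P u))) (countFin-false _ (λ u → 𝔹.∧-inverseʳ (P u))))
               (ℕ.+-identityʳ m))

-- A union of components has the rank of its φ-part.
component-rank : ∀ {n} (G : Graph n) (Q : Fin n → Bool) → (∀ a b → Q a ≡ true → Q b ≡ false → adj G b a ≡ false) →
  IsRank G (triples Q) (countFin Q)
component-rank G Q closed = subst (IsRank G (triples Q)) (∣Φ∣ Q)
  (basis⇒IsRank (triples Q) (Φ Q) Φ⊆ (Φ-independent Q) spans)
  where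
  open Columns G
  Φ⊆ : Φ Q ⊆ triples Q
  Φ⊆ (u , φ) e = e
  stays-inside : ∀ a k → Q a ≡ true → ∀ u → col (a , k) u ≡ true → Q u ≡ true
  stays-inside a k qa u e with Q u in qu
  ... | true = refl
  ... | false = ⊥-elim (true≢false (trans (≡-sym e) (vanishes k)))
    where
    u≢a : u ≢ a
    u≢a refl = true≢false (trans (≡-sym qa) qu)
    vanishes : ∀ k → col (a , k) u ≡ false
    vanishes φ = δ-≢ u≢a
    vanishes χ = closed a u qa qu
    vanishes ψ = cong₂ _xor_ (closed a u qa qu) (δ-≢ u≢a)
  spans : ∀ x → triples Q x ≡ true → Span col (Φ Q) (col x)
  spans (a , k) qa = span-supported (Φ Q) Q (λ u qu → span-∈ col (Φ Q) (u , φ) qu) (col (a , k)) (stays-inside a k qa)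

disconnected⇒τ≡κ*≡1 : ∀ {n} (G : Graph n) → Disconnected G → IsTau G (just 1) × IsKappa G 1
disconnected⇒τ≡κ*≡1 {n} G (P , (v , pv) , (w , pw) , no-edge) =
  τ≡κ*≡ G 1 S ordinary cyclic rank-full (ℕ.≤-trans (s≤s z≤n) (ℕ.m≤n⇒m≤n+o n (vertices v)))
    (¬ordinary<1 G) (¬cyclic<1 G)
  where
  open Columns G
  vertices : ∀ {m} → Fin m → 1 ≤ m
  vertices {suc m} _ = s≤s z≤n
  S = triples P
  λ<1 : LambdaLt G S 1
  λ<1 = 0 , (countFin P , countFin (λ u → not (P u)) , n ,
             component-rank G P (λ a b pa pb → trans (sym G b a) (no-edge a b pa pb)) ,
             component-rank G (λ u → not (P u)) (λ a b pa pb → no-edge b a (not-false pb) (not-true pa)) ,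
             rank-full , countFin-complement P) , s≤s z≤n
  ordinary : OrdinarySep G 1 S
  ordinary = λ<1 , member⇒∣∣≥1 S (v , φ) pv , member⇒∣∣≥1 (∁ S) (w , φ) (false⇒not-true pw)
  cyclic : CyclicSep G 1 S
  cyclic = λ<1 , triples-dependent G P (v , pv) , triples-dependent G (λ u → not (P u)) (w , false⇒not-true pw)

-- With one vertex, χ or ψ (whichever cancels the loop) is a zero column: a loop of M.
single-vertex⇒τ≡κ*≡1 : (G : Graph 1) → IsTau G (just 1) × IsKappa G 1
single-vertex⇒τ≡κ*≡1 G = τ≡κ*≡ G 1 S ordinary cyclic rank-full (s≤s z≤n) (¬ordinary<1 G) (¬cyclic<1 G)
  where
  open Columns G
  zero-column : Σ (W 1) λ z → proj₂ z ≢ φ × (∀ u → col z u ≡ false)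
  zero-column with adj G zero zero in loop
  ... | true = (zero , ψ) , (λ ()) , λ { zero → cong₂ _xor_ loop (δ-refl {1} zero) }
  ... | false = (zero , χ) , (λ ()) , λ { zero → loop }
  z = proj₁ zero-column
  col-z = proj₂ (proj₂ zero-column)
  S : Subset 1
  S = ｛ z ｝
  φ-outside : ∀ u → ∁ S (u , φ) ≡ true
  φ-outside u = cong not (｛｝-other {x = z} {y = (u , φ)} (λ eq → proj₁ (proj₂ zero-column) (cong proj₂ eq)))
  rank-S : IsRank G S 0
  rank-S = subst (IsRank G S) (∣∣-false {1} (λ _ → false) (λ _ → refl))
    (basis⇒IsRank S (λ _ → false) (λ _ ()) (λ { (R , R⊆ , (y , ry) , _) → true≢false (≡-sym (R⊆ y ry)) }) spans)
    where
    spans : ∀ x → S x ≡ true → Span col (λ _ → false) (col x)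
    spans x e with ｛｝-true {x = z} {y = x} e
    ... | refl = span-cong col (λ _ → false) (λ u → ≡-sym (col-z u)) (span-zero col (λ _ → false))
  λ<1 : LambdaLt G S 1
  λ<1 = 0 , (0 , 1 , 1 , rank-S , Φ-all⊆⇒rank-n (∁ S) (λ { (u , φ) _ → φ-outside u }) , rank-full , refl) , s≤s z≤n
  ordinary : OrdinarySep G 1 S
  ordinary = λ<1 , member⇒∣∣≥1 S z (｛｝-self z) , member⇒∣∣≥1 (∁ S) (zero , φ) (φ-outside zero)
  cyclic : CyclicSep G 1 S
  cyclic = λ<1 , (S , (λ _ e → e) , (z , ｛｝-self z) , λ u → trans (combination-｛｝ col z u) (col-z u)) ,
    (∁ S , (λ _ e → e) , ((zero , φ) , φ-outside zero) ,
     λ u → trans (combination-xor col (triples (λ _ → true)) S u)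
                 (cong₂ _xor_ (triple-sum G (λ _ → true) u) (trans (combination-｛｝ col z u) (col-z u))))

empty⇒κ*≡0∧τ≡∞ : (G : Graph 0) → IsKappa G 0 × IsTau G nothing
empty⇒κ*≡0∧τ≡∞ G = (0 , Columns.rank-full G , inj₁ refl , z≤n , (λ _ _ _ → z≤n)) , no-separation
  where
  no-separation : ∀ k S → ¬ OrdinarySep G k S
  no-separation zero S ((_ , _ , ()) , _)
  no-separation (suc k) S (_ , () , _)

module Decide {n : ℕ} (G : Graph n) where

  Splits : (Fin n → Bool) → Set
  Splits P = (∃ λ v → P v ≡ true) × (∃ λ w → P w ≡ false) × (∀ v w → P v ≡ true → P w ≡ false → adj G v w ≡ false)

  splits? : ∀ P → Dec (Splits P)
  splits? P = any? (λ v → P v 𝔹.≟ true) ×-dec any? (λ w → P w 𝔹.≟ false) ×-dec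
    all? (λ v → all? (λ w → (P v 𝔹.≟ true) →-dec (P w 𝔹.≟ false) →-dec (adj G v w 𝔹.≟ false)))

  splits-cong : ∀ {P Q} → (∀ i → P i ≡ Q i) → Splits P → Splits Q
  splits-cong P≗Q ((v , pv) , (w , pw) , no-edge) =
    (v , trans (≡-sym (P≗Q v)) pv) , (w , trans (≡-sym (P≗Q w)) pw) ,
    λ a b qa qb → no-edge a b (trans (P≗Q a) qa) (trans (P≗Q b) qb)

  disconnected? : Dec (Disconnected G)
  disconnected? = Dec.map′ (λ (V , s) → lookup V , s)
    (λ (P , s) → tabulate P , splits-cong (λ i → ≡-sym (lookup∘tabulate P i)) s)
    (anySubset? (λ V → splits? (lookup V)))

  nbr? : ∀ v u → Dec (Nbr G v u)
  nbr? v u = ¬? (u ≟ v) ×-dec (adj G v u 𝔹.≟ true)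

  pendant? : Dec (HasPendant G)
  pendant? = any? (λ v → any? (λ w → all? (λ u → (nbr? v u →-dec (u ≟ w)) ×-dec ((u ≟ w) →-dec nbr? v u))))

  twins? : Dec (HasTwins G)
  twins? = any? (λ v → any? (λ w → ¬? (v ≟ w) ×-dec all? (λ u →
    ((nbr? v u ×-dec ¬? (u ≟ w)) →-dec (nbr? w u ×-dec ¬? (u ≟ v))) ×-dec
    ((nbr? w u ×-dec ¬? (u ≟ v)) →-dec (nbr? v u ×-dec ¬? (u ≟ w))))))

cases : ∀ n (G : Graph n) → Case1 G ⊎ Case2 G ⊎ Case3 G ⊎ Case4 G
cases zero G = inj₁ refl
cases (suc zero) G = inj₂ (inj₁ (inj₁ refl))
cases (suc (suc m)) G with Decide.disconnected? G | Decide.pendant? G | Decide.twins? G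
... | yes disconnected | _ | _ = inj₂ (inj₁ (inj₂ disconnected))
... | no connected | yes pendant | _ = inj₂ (inj₂ (inj₁ (s≤s (s≤s z≤n) , connected , inj₁ pendant)))
... | no connected | no _ | yes twins = inj₂ (inj₂ (inj₁ (s≤s (s≤s z≤n) , connected , inj₂ twins)))
... | no connected | no no-pendant | no no-twins =
  inj₂ (inj₂ (inj₂ (s≤s (s≤s z≤n) , connected , no-pendant , no-twins)))

theorem1 : ∀ (n : ℕ) (G : Graph n) →
    (Case1 G ⊎ Case2 G ⊎ Case3 G ⊎ Case4 G) ×
    ¬ (Case1 G × Case2 G) × ¬ (Case1 G × Case3 G) × ¬ (Case1 G × Case4 G) ×
    ¬ (Case2 G × Case3 G) × ¬ (Case2 G × Case4 G) × ¬ (Case3 G × Case4 G) ×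
    (Case1 G → IsKappa G 0 × IsTau G nothing) ×
    (Case2 G → IsTau G (just 1) × IsKappa G 1) ×
    (Case3 G → IsTau G (just 2) × IsKappa G 2) ×
    (Case4 G → IsTau G (just 3) × IsKappa G 3)
theorem1 n G = cases n G ,
  (λ { (refl , inj₁ ()) ; (refl , inj₂ (_ , (() , _) , _)) }) ,
  (λ { (refl , () , _) }) , (λ { (refl , () , _) }) ,
  (λ { (inj₁ refl , s≤s () , _) ; (inj₂ d , _ , connected , _) → connected d }) ,
  (λ { (inj₁ refl , s≤s () , _) ; (inj₂ d , _ , connected , _) → connected d }) ,
  (λ { ((_ , _ , inj₁ p) , (_ , _ , no-pendant , _)) → no-pendant p
     ; ((_ , _ , inj₂ t) , (_ , _ , _ , no-twins)) → no-twins t }) ,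
  (λ { refl → empty⇒κ*≡0∧τ≡∞ G }) ,
  (λ { (inj₁ refl) → single-vertex⇒τ≡κ*≡1 G ; (inj₂ d) → disconnected⇒τ≡κ*≡1 G d }) ,
  (λ { (n>1 , connected , p-or-t) → ConnectedGraph.pendant-or-twins⇒τ≡κ*≡2 G connected n>1 p-or-t }) ,
  (λ { (n>1 , connected , no-pendant , no-twins) →
         ConnectedGraph.NoPendantNoTwins.τ≡κ*≡3 G connected n>1 no-pendant no-twins })
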